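{- There exists a data set of tuples in $U^m$ such that, for the algorithm that samples $r$ tuples uniformly at random and rejects a subset of coordinates $A$ exactly when some pair of sampled tuples is not separated by $A$, rejecting all bad subsets with probability exceeding $1/e$ when sampling with replacement (respectively $2/e$ when sampling without replacement) requires $r=\Omega\!\left(\sqrt{\frac{\log m}{\epsilon}}\right)$.
   Context: For a data set $\{x_1,\dots,x_n\}\subseteq U^m$, a subset $A\subseteq[m]$ separates $x_i,x_j$ if they differ in some coordinate of $A$; $A$ is bad if it separates fewer than $(1-\epsilon)\binom{n}{2}$ pairs of tuples. -}

module Defs where

open import Data.Nat as ℕ using (ℕ; zero; suc; _!)
open import Data.Nat.Properties using (_!≢0)
open import Data.Nat.Combinatorics using (_C_)
open import Data.Integer using (+_)
open import Data.Rational as ℚ using (ℚ; _/_; _+_; _*_; _-_; _<_; 1ℚ)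
open import Data.Rational.Properties as ℚP using ()
open import Data.Fin as Fin using (Fin)
open import Data.Fin.Properties as FinP using (any?; all?)
open import Data.Fin.Subset using (Subset; _∈_)
open import Data.Fin.Subset.Properties using (_∈?_; anySubset?)
open import Data.List as List using (List; []; _∷_; length; filter; allFin; concatMap; cartesianProduct)
open import Data.Vec.Functional as VF using (Vector)
open import Data.Product using (proj₁; proj₂; Σ; ∃; ∃-syntax; _×_; _,_)
open import Data.Empty using (⊥; ⊥-elim)
open import Relation.Nullary using (¬_; Dec; yes; no; ¬?)
open import Relation.Nullary.Decidable using (_×-dec_; decidable-stable)
open import Relation.Binary.PropositionalEquality using (_≡_; _≢_)

ℕ→ℚ : ℕ → ℚ
ℕ→ℚ k = + k / 1

-- Data sets: n tuples in U^m, with U = ℕ (the i-th tuple is x i)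

DataSet : ℕ → ℕ → Set
DataSet n m = Fin n → Fin m → ℕ

Separates : ∀ {m} → Subset m → (Fin m → ℕ) → (Fin m → ℕ) → Set
Separates A u v = ∃[ j ] (j ∈ A × u j ≢ v j)

separates? : ∀ {m} (A : Subset m) u v → Dec (Separates A u v)
separates? A u v = any? (λ j → (j ∈? A) ×-dec ¬? (u j ℕ.≟ v j))

separatedPairs : ∀ {n m} → DataSet n m → Subset m → ℕ
separatedPairs {n} x A =
  length (filter (λ p → (proj₁ p Fin.<? proj₂ p)
                        ×-dec separates? A (x (proj₁ p)) (x (proj₂ p)))
                 (cartesianProduct (allFin n) (allFin n)))

Bad : ∀ {n m} → ℚ → DataSet n m → Subset m → Set
Bad {n} ε x A = ℕ→ℚ (separatedPairs x A) < (1ℚ - ε) * ℕ→ℚ (n C 2)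

bad? : ∀ {n m} ε (x : DataSet n m) A → Dec (Bad ε x A)
bad? {n} ε x A = ℕ→ℚ (separatedPairs x A) ℚP.<? (1ℚ - ε) * ℕ→ℚ (n C 2)

-- A sample of size r is a sequence s : Fin r → Fin n of
-- indices of sampled tuples.

Rejects : ∀ {n m r} → DataSet n m → (Fin r → Fin n) → Subset m → Set
Rejects x s A = ∃[ a ] ∃[ b ] (a ≢ b × ¬ Separates A (x (s a)) (x (s b)))

rejects? : ∀ {n m r} (x : DataSet n m) s A → Dec (Rejects {r = r} x s A)
rejects? x s A = any? (λ a → any? (λ b → ¬? (a Fin.≟ b) ×-dec ¬? (separates? A (x (s a)) (x (s b)))))

RejectsAllBad : ∀ {n m r} → ℚ → DataSet n m → (Fin r → Fin n) → Set
RejectsAllBad ε x s = ∀ A → Bad ε x A → Rejects x s A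

rejectsAllBad? : ∀ {n m r} ε (x : DataSet n m) (s : Fin r → Fin n) → Dec (RejectsAllBad ε x s)
rejectsAllBad? ε x s = go (anySubset? (λ A → bad? ε x A ×-dec ¬? (rejects? x s A)))
  where
  go : Dec (∃[ A ] (Bad ε x A × ¬ Rejects x s A)) → Dec (RejectsAllBad ε x s)
  go (yes (A , bA , ¬rA)) = no (λ h → ¬rA (h A bA))
  go (no ¬ex) = yes (λ A bA → decidable-stable (rejects? x s A) (λ ¬rA → ¬ex (A , bA , ¬rA)))

-- all sequences Fin r → Fin n (sampling with replacement; n^r outcomes)
allSeqs : (r n : ℕ) → List (Fin r → Fin n)
allSeqs zero    n = (λ ()) ∷ []
allSeqs (suc r) n = concatMap (λ f → List.map (λ i → i VF.∷ f) (allFin n)) (allSeqs r n)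

-- injective sequences (sampling without replacement, ordered; n!/(n-r)! outcomes)
InjectiveSeq : ∀ {r n} → (Fin r → Fin n) → Set
InjectiveSeq s = ∀ a b → s a ≡ s b → a ≡ b

injectiveSeq? : ∀ {r n} (s : Fin r → Fin n) → Dec (InjectiveSeq s)
injectiveSeq? s = all? (λ a → all? (λ b → decImp (s a Fin.≟ s b) (a Fin.≟ b)))
  where
  decImp : ∀ {P Q : Set} → Dec P → Dec Q → Dec (P → Q)
  decImp _       (yes q) = yes (λ _ → q)
  decImp (yes p) (no ¬q) = no (λ f → ¬q (f p))
  decImp (no ¬p) (no _)  = yes (λ p → ⊥-elim (¬p p))

injSeqs : (r n : ℕ) → List (Fin r → Fin n)
injSeqs r n = filter injectiveSeq? (allSeqs r n)

successWith : ℚ → ∀ {n m} → DataSet n m → ℕ → ℕ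
successWith ε x r = length (filter (rejectsAllBad? ε x) (allSeqs r _))

successWithout : ℚ → ∀ {n m} → DataSet n m → ℕ → ℕ
successWithout ε x r = length (filter (rejectsAllBad? ε x) (injSeqs r _))

-- Comparison with a/e, where e = Σ_k 1/k!.
-- eSum N = Σ_{k ≤ N} 1/k!  (increasing, with limit e)

eSum : ℕ → ℚ
eSum zero    = 1ℚ
eSum (suc N) = eSum N + (+ 1 / (suc N !)) {{suc N !≢0}}

-- "good / total > a / e", i.e. good * e > a * total; since the partial
-- sums increase strictly to e this holds iff some partial sum witnesses it.
-- (If total = 0 then good = 0 and this is false.)
ExceedsOverE : ℕ → ℕ → ℕ → Set
ExceedsOverE a good total = ∃[ N ] (ℕ→ℚ (a ℕ.* total) < ℕ→ℚ good * eSum N)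

-- Write ε = p/d and ℓ = ⌊log₂ m⌋. The data set consists of all K^m words over the
-- alphabet Fin K, where in every coordinate the M smallest letters are merged into the single
-- value 0; here M = 2 + 2ℓd and K = 4bM with b ≈ 1/(8√ε). In one coordinate a fraction about
-- (M/K)² > ε of all pairs is unseparated, so every singleton set of coordinates is bad, and a
-- sample that rejects all bad sets must contain, in each of the m coordinates, two samples with
-- equal merged letters. The m columns of a uniform sample are independent. A column has no
-- such collision when its r letters are distinct and unmerged; if ε r² < ℓ / 1024 this has
-- probability at least (1 - (M + r)/K)^r ≥ 8/m, since blocks of b letters lose at most a factor 2
-- and r < ℓb/2. Bernoulli's inequality then bounds the success probability by (1 - 8/m)^m < 1/6.
-- Without replacement, r samples are distinct with probability at least 1/2 (as 2r² ≤ K^m), so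
-- the success probability is at most 1/3. Both bounds lie below 1/e and 2/e, because e ≤ 3.

module Submission where

open import Defs
open import Level using (Level)
open import Function using (_∘_; id)
open import Data.Nat as ℕ using (ℕ; zero; suc; _+_; _*_; _∸_; _^_; _≤_; _<_; z≤n; s≤s; _≤?_; _<?_; NonZero; _!; ⌊_/2⌋)
open import Data.Nat.Properties
open import Data.Nat.Combinatorics using (_C_; nC1≡n; nCk+nC[k+1]≡[n+1]C[k+1])
open import Data.Nat.Coprimality as Coprime using (Coprime; 1-coprimeTo)
open import Data.Nat.DivMod using (m≡m%n+[m/n]*n; m%n<n)
open import Data.Nat.Logarithm using (⌊log₂_⌋; ⌊log₂⌋-mono-≤; ⌊log₂⌊n/2⌋⌋≡⌊log₂n⌋∸1; ⌊log₂[2^n]⌋≡n)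
open import Data.Nat.Solver using (module +-*-Solver)
import Data.Nat.ListAction as ListAction
open import Data.Nat.ListAction.Properties using (sum-++)
open import Algebra.Properties.Semiring.Sum +-*-semiring
  using (sum; sum-syntax; sum-cong-≗; sum-replicate-zero; ∑-distrib-+; ∑-comm; *-distribˡ-sum; *-distribʳ-sum)
import Data.Integer as ℤ
import Data.Integer.Properties as ℤP
open import Data.Rational as ℚ using (ℚ; mkℚ; toℚᵘ; _/_; 0ℚ; 1ℚ; *≤*; *<*)
  renaming (_+_ to _+ℚ_; _*_ to _*ℚ_; _-_ to _-ℚ_; _<_ to _<ℚ_; _≤_ to _≤ℚ_)
import Data.Rational.Properties as ℚP
open import Data.Rational.Solver using () renaming (module +-*-Solver to ℚ-Solver)
open import Data.Rational.Unnormalised as ℚᵘ using (mkℚᵘ)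
import Data.Rational.Unnormalised.Properties as ℚᵘP
open import Data.Fin as Fin using (Fin; toℕ; _↑ˡ_; _↑ʳ_; combine; quotient; remainder; finToFun)
open import Data.Fin.Properties as FinP using (any?; all?; toℕ-injective; remQuot-combine)
open import Data.Fin.Subset using (Subset; ⁅_⁆)
open import Data.Fin.Subset.Properties using (x∈⁅x⁆; x∈⁅y⁆⇒x≡y)
open import Data.Vec.Functional as Vector using (Vector)
open import Data.List as List using (List; []; _∷_; _++_; length; filter; concatMap; tabulate; allFin; cartesianProduct)
open import Data.List.Properties using (map-++; map-cong; map-∘)
import Data.List.Relation.Binary.Sublist.Propositional.Properties as Sublist
open import Data.Product using (proj₁; proj₂; Σ; ∃-syntax; _×_; _,_)
open import Data.Unit using (tt)
open import Data.Empty using (⊥-elim)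
open import Relation.Nullary using (¬_; Dec; yes; no; ¬?)
open import Relation.Nullary.Decidable using (_×-dec_)
open import Relation.Binary.Core using (_Preserves_⟶_)
open import Relation.Binary.Definitions using (tri<; tri≈; tri>)
open import Relation.Binary.PropositionalEquality

-- Finite sums

∑-mono-≤ : ∀ {n} {f g : Vector ℕ n} → (∀ i → f i ≤ g i) → sum f ≤ sum g
∑-mono-≤ {zero}  f≤g = z≤n
∑-mono-≤ {suc n} f≤g = +-mono-≤ (f≤g Fin.zero) (∑-mono-≤ (f≤g ∘ Fin.suc))

∑-const : ∀ n c → ∑[ i < n ] c ≡ n * c
∑-const zero    c = refl
∑-const (suc n) c = cong (c +_) (∑-const n c)

f≤∑f : ∀ {n} (f : Vector ℕ n) i → f i ≤ sum f
f≤∑f f Fin.zero    = m≤m+n _ _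
f≤∑f f (Fin.suc i) = ≤-trans (f≤∑f (f ∘ Fin.suc) i) (m≤n+m _ _)

∑-∸ : ∀ {n} (f g : Vector ℕ n) → sum f ∸ sum g ≤ ∑[ i < n ] (f i ∸ g i)
∑-∸ f g = m≤n+o⇒m∸n≤o (sum f) (sum g)
  (≤-trans (∑-mono-≤ (λ i → m≤n+m∸n (f i) (g i))) (≤-reflexive (∑-distrib-+ g _)))

∑-↑ : ∀ m {n} (h : Vector ℕ (m + n)) → sum h ≡ ∑[ i < m ] h (i ↑ˡ n) + ∑[ j < n ] h (m ↑ʳ j)
∑-↑ zero    h = refl
∑-↑ (suc m) h = trans (cong (h Fin.zero +_) (∑-↑ m (h ∘ Fin.suc))) (sym (+-assoc (h Fin.zero) _ _))

∑-combine : ∀ m {n} (h : Vector ℕ (m * n)) → sum h ≡ ∑[ a < m ] ∑[ b < n ] h (combine a b)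
∑-combine zero        h = refl
∑-combine (suc m) {n} h = trans (∑-↑ n h) (cong (∑[ b < n ] h (b ↑ˡ (m * n)) +_) (∑-combine m (h ∘ (n ↑ʳ_))))

∑∑-* : ∀ {m n} (x : Vector ℕ m) (y : Vector ℕ n) → ∑[ a < m ] ∑[ b < n ] (x a * y b) ≡ sum x * sum y
∑∑-* {m} {n} x y = begin
  ∑[ a < m ] ∑[ b < n ] (x a * y b)  ≡⟨ sum-cong-≗ {m} (λ a → sym (*-distribˡ-sum (x a) y)) ⟩
  ∑[ a < m ] (x a * sum y)           ≡⟨ sym (*-distribʳ-sum (sum y) x) ⟩
  sum x * sum y                      ∎
  where open ≡-Reasoning

∑∑-distrib-+ : ∀ {m n} (f g : Fin m → Fin n → ℕ) →
               ∑[ i < m ] ∑[ j < n ] (f i j + g i j) ≡ ∑[ i < m ] ∑[ j < n ] f i j + ∑[ i < m ] ∑[ j < n ] g i j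
∑∑-distrib-+ {m} f g = trans (sum-cong-≗ {m} λ i → ∑-distrib-+ (f i) (g i)) (∑-distrib-+ (sum ∘ f) (sum ∘ g))

χ : ∀ {p} {P : Set p} → Dec P → ℕ
χ (yes _) = 1
χ (no _)  = 0

χ≤1 : ∀ {p} {P : Set p} (P? : Dec P) → χ P? ≤ 1
χ≤1 (yes _) = ≤-refl
χ≤1 (no _)  = z≤n

χ-yes : ∀ {p} {P : Set p} (P? : Dec P) → P → χ P? ≡ 1
χ-yes (yes _) _  = refl
χ-yes (no ¬p) p = ⊥-elim (¬p p)

χ-no : ∀ {p} {P : Set p} (P? : Dec P) → ¬ P → χ P? ≡ 0
χ-no (yes p) ¬p = ⊥-elim (¬p p)
χ-no (no _)  _  = refl

χ-mono : ∀ {p q} {P : Set p} {Q : Set q} (P? : Dec P) (Q? : Dec Q) → (P → Q) → χ P? ≤ χ Q?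
χ-mono (yes p) Q? P⇒Q = ≤-reflexive (sym (χ-yes Q? (P⇒Q p)))
χ-mono (no _)  Q? P⇒Q = z≤n

χ-cong : ∀ {p q} {P : Set p} {Q : Set q} (P? : Dec P) (Q? : Dec Q) → (P → Q) → (Q → P) → χ P? ≡ χ Q?
χ-cong P? Q? P⇒Q Q⇒P = ≤-antisym (χ-mono P? Q? P⇒Q) (χ-mono Q? P? Q⇒P)

χ-× : ∀ {p q} {P : Set p} {Q : Set q} (P? : Dec P) (Q? : Dec Q) → χ (P? ×-dec Q?) ≡ χ P? * χ Q?
χ-× (yes _) (yes _) = refl
χ-× (yes _) (no ¬q) = refl
χ-× (no _)  Q?      = refl

χ≤ : ∀ {p} {P : Set p} {x} (P? : Dec P) → (P → 1 ≤ x) → χ P? ≤ x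
χ≤ (yes p) 1≤x = 1≤x p
χ≤ (no _)  _   = z≤n

*χ≤ : ∀ {p} {P : Set p} c {x} (P? : Dec P) → (P → c ≤ x) → c * χ P? ≤ x
*χ≤ c (yes p) c≤x = ≤-trans (≤-reflexive (*-identityʳ c)) (c≤x p)
*χ≤ c (no _)  _   = ≤-trans (≤-reflexive (*-zeroʳ c)) z≤n

∑-δ : ∀ {n} (c : Fin n) (h : Vector ℕ n) → ∑[ i < n ] (χ (c Fin.≟ i) * h i) ≡ h c
∑-δ {suc n} Fin.zero    h = trans (cong₂ _+_ (*-identityˡ (h Fin.zero)) (sum-replicate-zero n)) (+-identityʳ _)
∑-δ {suc n} (Fin.suc c) h = trans
  (sum-cong-≗ {n} λ i → cong (_* h (Fin.suc i)) (χ-cong (Fin.suc c Fin.≟ Fin.suc i) (c Fin.≟ i) FinP.suc-injective (cong Fin.suc)))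
  (∑-δ c (h ∘ Fin.suc))

χ-any≤∑χ : ∀ {n} {P : Fin n → Set} (P? : ∀ i → Dec (P i)) → χ (any? P?) ≤ ∑[ i < n ] χ (P? i)
χ-any≤∑χ P? with any? P?
... | yes (i , p) = ≤-trans (≤-reflexive (sym (χ-yes (P? i) p))) (f≤∑f _ i)
... | no _        = z≤n

∑χ≤toℕ : ∀ n M → ∑[ i < n ] χ (M ≤? toℕ i) ≡ n ∸ M
∑χ≤toℕ zero    M       = sym (0∸n≡0 M)
∑χ≤toℕ (suc n) zero    =
  cong suc (trans (sum-cong-≗ {n} (λ i → χ-yes (0 ≤? toℕ (Fin.suc i)) z≤n)) (trans (∑-const n 1) (*-identityʳ n)))
∑χ≤toℕ (suc n) (suc M) =
  trans (sum-cong-≗ {n} (λ i → χ-cong (suc M ≤? suc (toℕ i)) (M ≤? toℕ i) ℕ.s≤s⁻¹ s≤s)) (∑χ≤toℕ n M)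

∑χtoℕ< : ∀ n M → M ≤ n → ∑[ i < n ] χ (toℕ i <? M) ≡ M
∑χtoℕ< n       zero    _         = trans (sum-cong-≗ {n} (λ i → χ-no (toℕ i <? 0) λ ())) (sum-replicate-zero n)
∑χtoℕ< (suc n) (suc M) (s≤s M≤n) =
  cong suc (trans (sum-cong-≗ {n} (λ i → χ-cong (suc (toℕ i) <? suc M) (toℕ i <? M) ℕ.s≤s⁻¹ s≤s)) (∑χtoℕ< n M M≤n))

private
  variable
    ℓ₁ ℓ₂ ℓ₃ : Level
    X : Set ℓ₁
    Y : Set ℓ₂

∑ₗ : (X → ℕ) → List X → ℕ
∑ₗ h xs = ListAction.sum (List.map h xs)

length-filter≡∑ₗχ : {P : X → Set ℓ₃} (P? : ∀ x → Dec (P x)) → ∀ xs → length (filter P? xs) ≡ ∑ₗ (χ ∘ P?) xs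
length-filter≡∑ₗχ P? []       = refl
length-filter≡∑ₗχ P? (x ∷ xs) with P? x
... | yes _ = cong suc (length-filter≡∑ₗχ P? xs)
... | no _  = length-filter≡∑ₗχ P? xs

∑ₗ-++ : ∀ (h : X → ℕ) xs ys → ∑ₗ h (xs ++ ys) ≡ ∑ₗ h xs + ∑ₗ h ys
∑ₗ-++ h xs ys = trans (cong ListAction.sum (map-++ h xs ys)) (sum-++ (List.map h xs) _)

∑ₗ-concatMap : ∀ (h : Y → ℕ) (g : X → List Y) xs → ∑ₗ h (concatMap g xs) ≡ ∑ₗ (∑ₗ h ∘ g) xs
∑ₗ-concatMap h g []       = refl
∑ₗ-concatMap h g (x ∷ xs) = trans (∑ₗ-++ h (g x) (concatMap g xs)) (cong (∑ₗ h (g x) +_) (∑ₗ-concatMap h g xs))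

∑ₗ-map : ∀ (h : Y → ℕ) (g : X → Y) xs → ∑ₗ h (List.map g xs) ≡ ∑ₗ (h ∘ g) xs
∑ₗ-map h g xs = cong ListAction.sum (sym (map-∘ xs))

∑ₗ-tabulate : ∀ {n} (h : X → ℕ) (f : Fin n → X) → ∑ₗ h (tabulate f) ≡ ∑[ i < n ] h (f i)
∑ₗ-tabulate {n = zero}  h f = refl
∑ₗ-tabulate {n = suc n} h f = cong (h (f Fin.zero) +_) (∑ₗ-tabulate h (f ∘ Fin.suc))

∑ₗ-cartesianProduct : ∀ (h : X × Y → ℕ) xs ys →
                      ∑ₗ h (cartesianProduct xs ys) ≡ ∑ₗ (λ x → ∑ₗ (λ y → h (x , y)) ys) xs
∑ₗ-cartesianProduct h []       ys = refl
∑ₗ-cartesianProduct h (x ∷ xs) ys = trans (∑ₗ-++ h (List.map (x ,_) ys) _)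
  (cong₂ _+_ (∑ₗ-map h (x ,_) ys) (∑ₗ-cartesianProduct h xs ys))

-- Sums over samples

∑Seq : ∀ r n → ((Fin r → Fin n) → ℕ) → ℕ
∑Seq zero    n h = h (λ ())
∑Seq (suc r) n h = ∑Seq r n (λ f → ∑[ i < n ] h (i Vector.∷ f))

∑ₗ-allSeqs : ∀ r n h → ∑ₗ h (allSeqs r n) ≡ ∑Seq r n h
∑ₗ-allSeqs zero    n h = +-identityʳ (h (λ ()))
∑ₗ-allSeqs (suc r) n h = begin
  ∑ₗ h (concatMap (λ f → List.map (Vector._∷ f) (allFin n)) (allSeqs r n))
    ≡⟨ ∑ₗ-concatMap h _ (allSeqs r n) ⟩
  ∑ₗ (λ f → ∑ₗ h (List.map (Vector._∷ f) (allFin n))) (allSeqs r n)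
    ≡⟨ cong ListAction.sum (map-cong (λ f → trans (∑ₗ-map h (Vector._∷ f) (allFin n))
        (∑ₗ-tabulate {n = n} (h ∘ (Vector._∷ f)) id)) (allSeqs r n)) ⟩
  ∑ₗ (λ f → ∑[ i < n ] h (i Vector.∷ f)) (allSeqs r n)
    ≡⟨ ∑ₗ-allSeqs r n _ ⟩
  ∑Seq (suc r) n h ∎
  where open ≡-Reasoning

length-filter-allSeqs : ∀ r n {P : (Fin r → Fin n) → Set ℓ₃} (P? : ∀ s → Dec (P s)) →
                        length (filter P? (allSeqs r n)) ≡ ∑Seq r n (χ ∘ P?)
length-filter-allSeqs r n P? = trans (length-filter≡∑ₗχ P? (allSeqs r n)) (∑ₗ-allSeqs r n (χ ∘ P?))

module _ {n : ℕ} where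

  ∑Seq-cong : ∀ r {g h : (Fin r → Fin n) → ℕ} → (∀ f → g f ≡ h f) → ∑Seq r n g ≡ ∑Seq r n h
  ∑Seq-cong zero    g≡h = g≡h _
  ∑Seq-cong (suc r) g≡h = ∑Seq-cong r (λ f → sum-cong-≗ {n} (λ i → g≡h (i Vector.∷ f)))

  ∑Seq-mono-≤ : ∀ r {g h : (Fin r → Fin n) → ℕ} → (∀ f → g f ≤ h f) → ∑Seq r n g ≤ ∑Seq r n h
  ∑Seq-mono-≤ zero    g≤h = g≤h _
  ∑Seq-mono-≤ (suc r) g≤h = ∑Seq-mono-≤ r (λ f → ∑-mono-≤ (λ i → g≤h (i Vector.∷ f)))

  ∑Seq-distrib-+ : ∀ r (g h : (Fin r → Fin n) → ℕ) → ∑Seq r n (λ f → g f + h f) ≡ ∑Seq r n g + ∑Seq r n h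
  ∑Seq-distrib-+ zero    g h = refl
  ∑Seq-distrib-+ (suc r) g h =
    trans (∑Seq-cong r (λ f → ∑-distrib-+ (λ i → g (i Vector.∷ f)) _)) (∑Seq-distrib-+ r _ _)

  ∑Seq-*ˡ : ∀ r c (h : (Fin r → Fin n) → ℕ) → ∑Seq r n (λ f → c * h f) ≡ c * ∑Seq r n h
  ∑Seq-*ˡ zero    c h = refl
  ∑Seq-*ˡ (suc r) c h =
    trans (∑Seq-cong r (λ f → sym (*-distribˡ-sum c (λ i → h (i Vector.∷ f))))) (∑Seq-*ˡ r c _)

  ∑Seq-∑ : ∀ r {k} (h : Fin k → (Fin r → Fin n) → ℕ) → ∑Seq r n (λ f → ∑[ a < k ] h a f) ≡ ∑[ a < k ] ∑Seq r n (h a)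
  ∑Seq-∑ zero    h = refl
  ∑Seq-∑ (suc r) {k} h = trans (∑Seq-cong r (λ f → ∑-comm {n} (λ i a → h a (i Vector.∷ f)))) (∑Seq-∑ r {k} _)

  ∑Seq-const : ∀ r c → ∑Seq r n (λ _ → c) ≡ c * n ^ r
  ∑Seq-const zero    c = sym (*-identityʳ c)
  ∑Seq-const (suc r) c = begin
    ∑Seq r n (λ _ → ∑[ i < n ] c) ≡⟨ ∑Seq-const r (∑[ i < n ] c) ⟩
    ∑[ i < n ] c * n ^ r          ≡⟨ cong (_* n ^ r) (trans (∑-const n c) (*-comm n c)) ⟩
    c * n * n ^ r                 ≡⟨ *-assoc c n _ ⟩
    c * n ^ suc r                 ∎
    where open ≡-Reasoning

∷-cong : ∀ {r n} (i : Fin n) {f g : Fin r → Fin n} → f ≗ g → (i Vector.∷ f) ≗ (i Vector.∷ g)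
∷-cong i f≗g Fin.zero    = refl
∷-cong i f≗g (Fin.suc a) = f≗g a

-- The weights must respect pointwise equality: quotient N ∘ (combine a b ∷ f) and
-- a ∷ (quotient N ∘ f) agree only pointwise.
∑Seq-quotient-remainder : ∀ r {K N} (A : (Fin r → Fin K) → ℕ) (B : (Fin r → Fin N) → ℕ) →
  A Preserves _≗_ ⟶ _≡_ → B Preserves _≗_ ⟶ _≡_ →
  ∑Seq r (K * N) (λ s → A (quotient N ∘ s) * B (remainder {K} N ∘ s)) ≡ ∑Seq r K A * ∑Seq r N B
∑Seq-quotient-remainder zero            A B A-ext B-ext = cong₂ _*_ (A-ext λ ()) (B-ext λ ())
∑Seq-quotient-remainder (suc r) {K} {N} A B A-ext B-ext = begin
  ∑Seq r (K * N) (λ f → ∑[ i < K * N ] (A (quotient N ∘ (i Vector.∷ f)) * B (remainder {K} N ∘ (i Vector.∷ f))))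
    ≡⟨ ∑Seq-cong r (λ f → trans (∑-combine K _) (sum-cong-≗ {K} (λ a → sum-cong-≗ {N} (λ b → split f a b)))) ⟩
  ∑Seq r (K * N) (λ f → ∑[ a < K ] ∑[ b < N ] (A (a Vector.∷ (quotient N ∘ f)) * B (b Vector.∷ (remainder {K} N ∘ f))))
    ≡⟨ trans (∑Seq-∑ r {K} _) (sum-cong-≗ {K} (λ a → ∑Seq-∑ r {N} _)) ⟩
  ∑[ a < K ] ∑[ b < N ] ∑Seq r (K * N) (λ f → A (a Vector.∷ (quotient N ∘ f)) * B (b Vector.∷ (remainder {K} N ∘ f)))
    ≡⟨ sum-cong-≗ {K} (λ a → sum-cong-≗ {N} (λ b →
         ∑Seq-quotient-remainder r (A ∘ (a Vector.∷_)) (B ∘ (b Vector.∷_)) (A-ext ∘ ∷-cong a) (B-ext ∘ ∷-cong b))) ⟩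
  ∑[ a < K ] ∑[ b < N ] (∑Seq r K (A ∘ (a Vector.∷_)) * ∑Seq r N (B ∘ (b Vector.∷_)))
    ≡⟨ ∑∑-* (λ a → ∑Seq r K (A ∘ (a Vector.∷_))) (λ b → ∑Seq r N (B ∘ (b Vector.∷_))) ⟩
  ∑[ a < K ] ∑Seq r K (A ∘ (a Vector.∷_)) * ∑[ b < N ] ∑Seq r N (B ∘ (b Vector.∷_))
    ≡⟨ sym (cong₂ _*_ (∑Seq-∑ r {K} _) (∑Seq-∑ r {N} _)) ⟩
  ∑Seq (suc r) K A * ∑Seq (suc r) N B ∎
  where
  open ≡-Reasoning
  split : ∀ f a b → A (quotient N ∘ (combine a b Vector.∷ f)) * B (remainder {K} N ∘ (combine a b Vector.∷ f))
                  ≡ A (a Vector.∷ (quotient N ∘ f)) * B (b Vector.∷ (remainder {K} N ∘ f))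
  split f a b = cong₂ _*_
    (A-ext λ { Fin.zero → cong proj₁ (remQuot-combine a b) ; (Fin.suc _) → refl })
    (B-ext λ { Fin.zero → cong proj₂ (remQuot-combine a b) ; (Fin.suc _) → refl })

column : ∀ {r K m} → (Fin r → Fin (K ^ m)) → Fin m → Fin r → Fin K
column s j a = finToFun (s a) j

-- The product of A over the m columns of s: finToFun reads the first digit with quotient and
-- the remaining ones from the remainder.
∏Columns : ∀ {r K} m → ((Fin r → Fin K) → ℕ) → (Fin r → Fin (K ^ m)) → ℕ
∏Columns         zero    A s = 1
∏Columns {K = K} (suc m) A s = A (quotient (K ^ m) ∘ s) * ∏Columns m A (remainder {K} (K ^ m) ∘ s)

module _ {r K : ℕ} {A : (Fin r → Fin K) → ℕ} (A-ext : A Preserves _≗_ ⟶ _≡_) where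

  ∏Columns-ext : ∀ m → ∏Columns m A Preserves _≗_ ⟶ _≡_
  ∏Columns-ext zero    s≗t = refl
  ∏Columns-ext (suc m) s≗t =
    cong₂ _*_ (A-ext (cong (quotient (K ^ m)) ∘ s≗t)) (∏Columns-ext m (cong (remainder {K} (K ^ m)) ∘ s≗t))

  ∑Seq-∏Columns : ∀ m → ∑Seq r (K ^ m) (∏Columns m A) ≡ ∑Seq r K A ^ m
  ∑Seq-∏Columns zero    = trans (∑Seq-const r 1) (trans (*-identityˡ (1 ^ r)) (^-zeroˡ r))
  ∑Seq-∏Columns (suc m) =
    trans (∑Seq-quotient-remainder r A (∏Columns m A) A-ext (∏Columns-ext m)) (cong (∑Seq r K A *_) (∑Seq-∏Columns m))

∏Columns-χ : ∀ {r K} m {P : (Fin r → Fin K) → Set} (P? : ∀ g → Dec (P g)) (s : Fin r → Fin (K ^ m)) →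
             (∀ j → P (column {m = m} s j)) → ∏Columns m (χ ∘ P?) s ≡ 1
∏Columns-χ zero    P? s all = refl
∏Columns-χ {K = K} (suc m) P? s all =
  cong₂ _*_ (χ-yes (P? _) (all Fin.zero)) (∏Columns-χ m P? (remainder {K} (K ^ m) ∘ s) (all ∘ Fin.suc))

-- Injective samples and collisions

module _ {r N : ℕ} (f : Fin r → Fin N) where

  InImage? : ∀ i → Dec (∃[ a ] f a ≡ i)
  InImage? i = any? (λ a → f a Fin.≟ i)

  ∑χ-InImage≤ : ∑[ i < N ] χ (InImage? i) ≤ r
  ∑χ-InImage≤ = begin
    ∑[ i < N ] χ (InImage? i)
      ≤⟨ ∑-mono-≤ (λ i → χ-any≤∑χ (λ a → f a Fin.≟ i)) ⟩
    ∑[ i < N ] ∑[ a < r ] χ (f a Fin.≟ i)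
      ≡⟨ ∑-comm {N} (λ i a → χ (f a Fin.≟ i)) ⟩
    ∑[ a < r ] ∑[ i < N ] χ (f a Fin.≟ i)
      ≡⟨ sum-cong-≗ {r} (λ a → trans (sum-cong-≗ {N} (λ i → sym (*-identityʳ _))) (∑-δ (f a) (λ _ → 1))) ⟩
    ∑[ a < r ] 1
      ≡⟨ trans (∑-const r 1) (*-identityʳ r) ⟩
    r ∎
    where open ≤-Reasoning

  ∑χ-fresh≥ : ∀ M → (N ∸ M) ∸ r ≤ ∑[ i < N ] χ ((M ≤? toℕ i) ×-dec ¬? (InImage? i))
  ∑χ-fresh≥ M = begin
    (N ∸ M) ∸ r                                        ≤⟨ ∸-monoʳ-≤ (N ∸ M) ∑χ-InImage≤ ⟩
    (N ∸ M) ∸ ∑[ i < N ] χ (InImage? i)                ≡⟨ cong (_∸ ∑[ i < N ] χ (InImage? i)) (sym (∑χ≤toℕ N M)) ⟩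
    ∑[ i < N ] χ (M ≤? toℕ i) ∸ ∑[ i < N ] χ (InImage? i) ≤⟨ ∑-∸ (λ i → χ (M ≤? toℕ i)) (χ ∘ InImage?) ⟩
    ∑[ i < N ] (χ (M ≤? toℕ i) ∸ χ (InImage? i))      ≤⟨ ∑-mono-≤ (λ i → χ∸χ≤χ× (M ≤? toℕ i) (InImage? i)) ⟩
    ∑[ i < N ] χ ((M ≤? toℕ i) ×-dec ¬? (InImage? i)) ∎
    where
    open ≤-Reasoning
    χ∸χ≤χ× : ∀ {P Q : Set} (P? : Dec P) (Q? : Dec Q) → χ P? ∸ χ Q? ≤ χ (P? ×-dec ¬? Q?)
    χ∸χ≤χ× (yes _) (yes _) = z≤n
    χ∸χ≤χ× (yes _) (no _)  = ≤-refl
    χ∸χ≤χ× (no _)  Q?      = ≤-reflexive (0∸n≡0 (χ Q?))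

module _ {N : ℕ} (M : ℕ) where

  InjectiveAbove : ∀ {r} → (Fin r → Fin N) → Set
  InjectiveAbove s = (∀ a → M ≤ toℕ (s a)) × InjectiveSeq s

  injectiveAbove? : ∀ {r} (s : Fin r → Fin N) → Dec (InjectiveAbove s)
  injectiveAbove? s = all? (λ a → M ≤? toℕ (s a)) ×-dec injectiveSeq? s

  InjectiveAbove-∷ : ∀ {r} {f : Fin r → Fin N} {i} → M ≤ toℕ i → ¬ (∃[ a ] f a ≡ i) →
                     InjectiveAbove f → InjectiveAbove (i Vector.∷ f)
  InjectiveAbove-∷ {f = f} {i} M≤i fresh (above , inj) = above′ , inj′
    where
    above′ : ∀ a → M ≤ toℕ ((i Vector.∷ f) a)
    above′ Fin.zero    = M≤i
    above′ (Fin.suc a) = above a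
    inj′ : InjectiveSeq (i Vector.∷ f)
    inj′ Fin.zero    Fin.zero    _  = refl
    inj′ Fin.zero    (Fin.suc b) eq = ⊥-elim (fresh (b , sym eq))
    inj′ (Fin.suc a) Fin.zero    eq = ⊥-elim (fresh (a , eq))
    inj′ (Fin.suc a) (Fin.suc b) eq = cong Fin.suc (inj a b eq)

  ∑Seq-injectiveAbove≥ : ∀ r → ((N ∸ M) ∸ r) ^ r ≤ ∑Seq r N (χ ∘ injectiveAbove?)
  ∑Seq-injectiveAbove≥ zero    = ≤-refl
  ∑Seq-injectiveAbove≥ (suc r) = begin
    ((N ∸ M) ∸ suc r) ^ suc r                        ≤⟨ ^-monoˡ-≤ (suc r) (∸-monoʳ-≤ (N ∸ M) (n≤1+n r)) ⟩
    c * c ^ r                                        ≤⟨ *-monoʳ-≤ c (∑Seq-injectiveAbove≥ r) ⟩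
    c * ∑Seq r N (χ ∘ injectiveAbove?)               ≡⟨ sym (∑Seq-*ˡ r c _) ⟩
    ∑Seq r N (λ f → c * χ (injectiveAbove? f))       ≤⟨ ∑Seq-mono-≤ r extensions ⟩
    ∑Seq (suc r) N (χ ∘ injectiveAbove?)             ∎
    where
    open ≤-Reasoning
    c : ℕ
    c = (N ∸ M) ∸ r
    extensions : ∀ f → c * χ (injectiveAbove? f) ≤ ∑[ i < N ] χ (injectiveAbove? (i Vector.∷ f))
    extensions f = *χ≤ c (injectiveAbove? f) λ inj → begin
      c
        ≤⟨ ∑χ-fresh≥ f M ⟩
      ∑[ i < N ] χ ((M ≤? toℕ i) ×-dec ¬? (InImage? f i))
        ≤⟨ ∑-mono-≤ (λ i → χ-mono ((M ≤? toℕ i) ×-dec ¬? (InImage? f i)) (injectiveAbove? (i Vector.∷ f))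
            (λ (M≤i , fresh) → InjectiveAbove-∷ M≤i fresh inj)) ⟩
      ∑[ i < N ] χ (injectiveAbove? (i Vector.∷ f)) ∎

successWithout≤successWith : ∀ ε {n m} (x : DataSet n m) r → successWithout ε x r ≤ successWith ε x r
successWithout≤successWith ε {n} x r =
  Sublist.length-mono-≤ (Sublist.filter⁺ (rejectsAllBad? ε x) (rejectsAllBad? ε x) (λ { refl → id })
                                         (Sublist.filter-⊆ injectiveSeq? (allSeqs r n)))

[n∸r]^r≤#injSeqs : ∀ r n → (n ∸ r) ^ r ≤ length (injSeqs r n)
[n∸r]^r≤#injSeqs r n = begin
  (n ∸ r) ^ r
    ≤⟨ ∑Seq-injectiveAbove≥ 0 r ⟩
  ∑Seq r n (χ ∘ injectiveAbove? 0)
    ≤⟨ ∑Seq-mono-≤ r (λ s → χ-mono (injectiveAbove? 0 s) (injectiveSeq? s) proj₂) ⟩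
  ∑Seq r n (χ ∘ injectiveSeq?)
    ≡⟨ sym (length-filter-allSeqs r n injectiveSeq?) ⟩
  length (injSeqs r n) ∎
  where open ≤-Reasoning

merge : ℕ → ∀ {K} → Fin K → ℕ
merge M a with toℕ a <? M
... | yes _ = 0
... | no _  = toℕ a

merge-< : ∀ M {K} (a : Fin K) → toℕ a < M → merge M a ≡ 0
merge-< M a a<M with toℕ a <? M
... | yes _   = refl
... | no a≮M = ⊥-elim (a≮M a<M)

merge-≥ : ∀ M {K} (a : Fin K) → M ≤ toℕ a → merge M a ≡ toℕ a
merge-≥ M a M≤a with toℕ a <? M
... | yes a<M = ⊥-elim (<⇒≱ a<M M≤a)
... | no _    = refl

module _ (M : ℕ) {r K : ℕ} where

  Collision : (Fin r → Fin K) → Set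
  Collision g = ∃[ a ] ∃[ b ] (a ≢ b × merge M (g a) ≡ merge M (g b))

  collision? : ∀ g → Dec (Collision g)
  collision? g = any? λ a → any? λ b → ¬? (a Fin.≟ b) ×-dec (merge M (g a) ℕ.≟ merge M (g b))

  χ-collision-ext : (χ ∘ collision?) Preserves _≗_ ⟶ _≡_
  χ-collision-ext {g} {h} g≗h = χ-cong (collision? g) (collision? h) (transport g≗h) (transport (sym ∘ g≗h))
    where
    transport : ∀ {g h} → g ≗ h → Collision g → Collision h
    transport g≗h (a , b , a≢b , eq) = a , b , a≢b , trans (cong (merge M) (sym (g≗h a))) (trans eq (cong (merge M) (g≗h b)))

  InjectiveAbove⇒¬Collision : ∀ {g} → InjectiveAbove M g → ¬ Collision g
  InjectiveAbove⇒¬Collision {g} (above , inj) (a , b , a≢b , eq) =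
    a≢b (inj a b (toℕ-injective (trans (sym (merge-≥ M (g a) (above a))) (trans eq (merge-≥ M (g b) (above b))))))

  ∑Seq-collision+[K∸M∸r]^r≤K^r : ∑Seq r K (χ ∘ collision?) + ((K ∸ M) ∸ r) ^ r ≤ K ^ r
  ∑Seq-collision+[K∸M∸r]^r≤K^r = begin
    ∑Seq r K (χ ∘ collision?) + ((K ∸ M) ∸ r) ^ r                   ≤⟨ +-monoʳ-≤ _ (∑Seq-injectiveAbove≥ M r) ⟩
    ∑Seq r K (χ ∘ collision?) + ∑Seq r K (χ ∘ injectiveAbove? M)     ≡⟨ sym (∑Seq-distrib-+ r _ _) ⟩
    ∑Seq r K (λ g → χ (collision? g) + χ (injectiveAbove? M g))      ≤⟨ ∑Seq-mono-≤ r exclusive ⟩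
    ∑Seq r K (λ _ → 1)                                               ≡⟨ trans (∑Seq-const r 1) (*-identityˡ (K ^ r)) ⟩
    K ^ r                                                            ∎
    where
    open ≤-Reasoning
    exclusive : ∀ g → χ (collision? g) + χ (injectiveAbove? M g) ≤ 1
    exclusive g with injectiveAbove? M g
    ... | no _   = ≤-trans (≤-reflexive (+-identityʳ _)) (χ≤1 (collision? g))
    ... | yes ia = ≤-reflexive (cong (_+ 1) (χ-no (collision? g) (InjectiveAbove⇒¬Collision ia)))

-- Counting pairs

χ-trichotomy : ∀ {n} (i j : Fin n) → χ (i Fin.<? j) + χ (j Fin.<? i) + χ (i Fin.≟ j) ≡ 1
χ-trichotomy i j with FinP.<-cmp i j
... | tri< i<j i≢j j≮i = cong₂ _+_ (cong₂ _+_ (χ-yes (i Fin.<? j) i<j) (χ-no (j Fin.<? i) j≮i)) (χ-no (i Fin.≟ j) i≢j)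
... | tri≈ i≮j i≡j j≮i = cong₂ _+_ (cong₂ _+_ (χ-no (i Fin.<? j) i≮j) (χ-no (j Fin.<? i) j≮i)) (χ-yes (i Fin.≟ j) i≡j)
... | tri> i≮j i≢j j<i = cong₂ _+_ (cong₂ _+_ (χ-no (i Fin.<? j) i≮j) (χ-yes (j Fin.<? i) j<i)) (χ-no (i Fin.≟ j) i≢j)

χ+χ¬≡1 : ∀ {p} {P : Set p} (P? : Dec P) → χ P? + χ (¬? P?) ≡ 1
χ+χ¬≡1 (yes _) = refl
χ+χ¬≡1 (no _)  = refl

module _ {n : ℕ} where

  #pairs : ∀ {R : Fin n → Fin n → Set} → (∀ i j → Dec (R i j)) → ℕ
  #pairs R? = ∑[ i < n ] ∑[ j < n ] (χ (i Fin.<? j) * χ (R? i j))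

  #pairs-mono-≤ : ∀ {R S : Fin n → Fin n → Set} (R? : ∀ i j → Dec (R i j)) (S? : ∀ i j → Dec (S i j)) →
                  (∀ {i j} → R i j → S i j) → #pairs R? ≤ #pairs S?
  #pairs-mono-≤ R? S? R⇒S = ∑-mono-≤ λ i → ∑-mono-≤ λ j → *-monoʳ-≤ (χ (i Fin.<? j)) (χ-mono (R? i j) (S? i j) R⇒S)

  #pairs-symmetric : ∀ {R : Fin n → Fin n → Set} (R? : ∀ i j → Dec (R i j)) → (∀ {i j} → R i j → R j i) →
                     2 * #pairs R? + ∑[ i < n ] χ (R? i i) ≡ ∑[ i < n ] ∑[ j < n ] χ (R? i j)
  #pairs-symmetric R? sym-R = sym (begin
    ∑[ i < n ] ∑[ j < n ] χ (R? i j)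
      ≡⟨ sum-cong-≗ {n} (λ i → sum-cong-≗ {n} (λ j → sym (split i j))) ⟩
    ∑[ i < n ] ∑[ j < n ] (χ (i Fin.<? j) * χ (R? i j) + χ (j Fin.<? i) * χ (R? i j) + χ (i Fin.≟ j) * χ (R? i j))
      ≡⟨ ∑∑-distrib-+ (λ i j → χ (i Fin.<? j) * χ (R? i j) + χ (j Fin.<? i) * χ (R? i j))
                      (λ i j → χ (i Fin.≟ j) * χ (R? i j)) ⟩
    ∑[ i < n ] ∑[ j < n ] (χ (i Fin.<? j) * χ (R? i j) + χ (j Fin.<? i) * χ (R? i j)) + diagonal
      ≡⟨ cong (_+ diagonal) (∑∑-distrib-+ (λ i j → χ (i Fin.<? j) * χ (R? i j)) (λ i j → χ (j Fin.<? i) * χ (R? i j))) ⟩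
    #pairs R? + above + diagonal
      ≡⟨ cong₂ _+_ (cong (#pairs R? +_) (trans above≡below (sym (+-identityʳ _)))) diagonal≡ ⟩
    2 * #pairs R? + ∑[ i < n ] χ (R? i i) ∎)
    where
    open ≡-Reasoning
    open +-*-Solver
    above diagonal : ℕ
    above    = ∑[ i < n ] ∑[ j < n ] (χ (j Fin.<? i) * χ (R? i j))
    diagonal = ∑[ i < n ] ∑[ j < n ] (χ (i Fin.≟ j) * χ (R? i j))
    above≡below : above ≡ #pairs R?
    above≡below = trans (∑-comm {n} {n} (λ i j → χ (j Fin.<? i) * χ (R? i j)))
      (sum-cong-≗ {n} λ i → sum-cong-≗ {n} λ j → cong (χ (i Fin.<? j) *_) (χ-cong (R? j i) (R? i j) sym-R sym-R))
    diagonal≡ : diagonal ≡ ∑[ i < n ] χ (R? i i)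
    diagonal≡ = sum-cong-≗ {n} λ i → ∑-δ i (χ ∘ R? i)
    split : ∀ i j → χ (i Fin.<? j) * χ (R? i j) + χ (j Fin.<? i) * χ (R? i j) + χ (i Fin.≟ j) * χ (R? i j) ≡ χ (R? i j)
    split i j = begin
      χ (i Fin.<? j) * χ (R? i j) + χ (j Fin.<? i) * χ (R? i j) + χ (i Fin.≟ j) * χ (R? i j)
        ≡⟨ solve 4 (λ a b c r → a :* r :+ b :* r :+ c :* r := (a :+ b :+ c) :* r) refl
                   (χ (i Fin.<? j)) (χ (j Fin.<? i)) (χ (i Fin.≟ j)) (χ (R? i j)) ⟩
      (χ (i Fin.<? j) + χ (j Fin.<? i) + χ (i Fin.≟ j)) * χ (R? i j)
        ≡⟨ cong (_* χ (R? i j)) (χ-trichotomy i j) ⟩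
      1 * χ (R? i j)
        ≡⟨ *-identityˡ _ ⟩
      χ (R? i j) ∎

2*#pairs[P×P]+#P≡#P*#P : ∀ {n} {P : Fin n → Set} (P? : ∀ i → Dec (P i)) →
                         2 * #pairs (λ i j → P? i ×-dec P? j) + ∑[ i < n ] χ (P? i) ≡ ∑[ i < n ] χ (P? i) * ∑[ i < n ] χ (P? i)
2*#pairs[P×P]+#P≡#P*#P {n} P? = begin
  2 * #pairs (λ i j → P? i ×-dec P? j) + ∑[ i < n ] χ (P? i)
    ≡⟨ cong (2 * #pairs (λ i j → P? i ×-dec P? j) +_) (sum-cong-≗ {n} λ i → χ-cong (P? i) (P? i ×-dec P? i) (λ p → p , p) proj₁) ⟩
  2 * #pairs (λ i j → P? i ×-dec P? j) + ∑[ i < n ] χ (P? i ×-dec P? i)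
    ≡⟨ #pairs-symmetric (λ i j → P? i ×-dec P? j) (λ (p , q) → q , p) ⟩
  ∑[ i < n ] ∑[ j < n ] χ (P? i ×-dec P? j)
    ≡⟨ sum-cong-≗ {n} (λ i → sum-cong-≗ {n} λ j → χ-× (P? i) (P? j)) ⟩
  ∑[ i < n ] ∑[ j < n ] (χ (P? i) * χ (P? j))
    ≡⟨ ∑∑-* (χ ∘ P?) (χ ∘ P?) ⟩
  ∑[ i < n ] χ (P? i) * ∑[ i < n ] χ (P? i) ∎
  where open ≡-Reasoning

2*nC2+n≡n*n : ∀ n → 2 * (n C 2) + n ≡ n * n
2*nC2+n≡n*n zero    = refl
2*nC2+n≡n*n (suc n) = begin
  2 * (suc n C 2) + suc n
    ≡⟨ cong (λ c → 2 * c + suc n) (sym (nCk+nC[k+1]≡[n+1]C[k+1] n 1)) ⟩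
  2 * (n C 1 + n C 2) + suc n
    ≡⟨ cong (λ c → 2 * (c + n C 2) + suc n) (nC1≡n n) ⟩
  2 * (n + n C 2) + suc n
    ≡⟨ solve 2 (λ n c → con 2 :* (n :+ c) :+ (con 1 :+ n) := (con 2 :* c :+ n) :+ con 2 :* n :+ con 1) refl n (n C 2) ⟩
  (2 * (n C 2) + n) + 2 * n + 1
    ≡⟨ cong (λ k → k + 2 * n + 1) (2*nC2+n≡n*n n) ⟩
  n * n + 2 * n + 1
    ≡⟨ solve 1 (λ n → n :* n :+ con 2 :* n :+ con 1 := (con 1 :+ n) :* (con 1 :+ n)) refl n ⟩
  suc n * suc n ∎
  where
  open ≡-Reasoning
  open +-*-Solver

#pairs-all≡nC2 : ∀ n → #pairs {n} (λ _ _ → yes tt) ≡ n C 2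
#pairs-all≡nC2 n = *-cancelˡ-≡ _ _ 2 (+-cancelʳ-≡ n _ _ (begin
  2 * #pairs {n} (λ _ _ → yes tt) + n
    ≡⟨ cong (2 * #pairs {n} (λ _ _ → yes tt) +_) (sym (trans (∑-const n 1) (*-identityʳ n))) ⟩
  2 * #pairs {n} (λ _ _ → yes tt) + ∑[ i < n ] 1
    ≡⟨ #pairs-symmetric {n} (λ _ _ → yes tt) (λ _ → tt) ⟩
  ∑[ i < n ] ∑[ j < n ] 1
    ≡⟨ trans (sum-cong-≗ {n} (λ _ → trans (∑-const n 1) (*-identityʳ n))) (∑-const n n) ⟩
  n * n
    ≡⟨ sym (2*nC2+n≡n*n n) ⟩
  2 * (n C 2) + n ∎))
  where open ≡-Reasoning

module _ {n m} (x : DataSet n m) (A : Subset m) where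

  separatedPairs≡#pairs : separatedPairs x A ≡ #pairs (λ i j → separates? A (x i) (x j))
  separatedPairs≡#pairs = begin
    separatedPairs x A
      ≡⟨ length-filter≡∑ₗχ P? (List.cartesianProduct (allFin n) (allFin n)) ⟩
    ∑ₗ (χ ∘ P?) (List.cartesianProduct (allFin n) (allFin n))
      ≡⟨ ∑ₗ-cartesianProduct (χ ∘ P?) (allFin n) (allFin n) ⟩
    ∑ₗ (λ i → ∑ₗ (λ j → χ (P? (i , j))) (allFin n)) (allFin n)
      ≡⟨ trans (∑ₗ-tabulate (λ i → ∑ₗ (λ j → χ (P? (i , j))) (allFin n)) id)
               (sum-cong-≗ {n} λ i → ∑ₗ-tabulate (λ j → χ (P? (i , j))) id) ⟩
    ∑[ i < n ] ∑[ j < n ] χ (P? (i , j))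
      ≡⟨ sum-cong-≗ {n} (λ i → sum-cong-≗ {n} λ j → χ-× (i Fin.<? j) (separates? A (x i) (x j))) ⟩
    #pairs (λ i j → separates? A (x i) (x j)) ∎
    where
    open ≡-Reasoning
    P? : ∀ (p : Fin n × Fin n) → Dec ((proj₁ p Fin.< proj₂ p) × Separates A (x (proj₁ p)) (x (proj₂ p)))
    P? (i , j) = (i Fin.<? j) ×-dec separates? A (x i) (x j)

  separatedPairs+unseparated≡nC2 : separatedPairs x A + #pairs (λ i j → ¬? (separates? A (x i) (x j))) ≡ n C 2
  separatedPairs+unseparated≡nC2 = begin
    separatedPairs x A + #pairs (λ i j → ¬? (separates? A (x i) (x j)))
      ≡⟨ cong (_+ unseparated) separatedPairs≡#pairs ⟩
    #pairs (λ i j → separates? A (x i) (x j)) + #pairs (λ i j → ¬? (separates? A (x i) (x j)))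
      ≡⟨ sym (∑∑-distrib-+ (λ i j → χ (i Fin.<? j) * χ (separates? A (x i) (x j)))
                           (λ i j → χ (i Fin.<? j) * χ (¬? (separates? A (x i) (x j))))) ⟩
    ∑[ i < n ] ∑[ j < n ] (χ (i Fin.<? j) * χ (separates? A (x i) (x j)) + χ (i Fin.<? j) * χ (¬? (separates? A (x i) (x j))))
      ≡⟨ sum-cong-≗ {n} (λ i → sum-cong-≗ {n} λ j → trans (sym (*-distribˡ-+ (χ (i Fin.<? j)) _ _))
          (cong (χ (i Fin.<? j) *_) (χ+χ¬≡1 (separates? A (x i) (x j))))) ⟩
    #pairs {n} (λ _ _ → yes tt)
      ≡⟨ #pairs-all≡nC2 n ⟩
    n C 2 ∎
    where
    open ≡-Reasoning
    unseparated : ℕ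
    unseparated = #pairs (λ i j → ¬? (separates? A (x i) (x j)))

∑-finToFun : ∀ {K} m (j : Fin (suc m)) (h : Fin K → ℕ) → ∑[ i < K ^ suc m ] h (finToFun i j) ≡ K ^ m * sum h
∑-finToFun {K} m Fin.zero h = begin
  ∑[ i < K * K ^ m ] h (quotient (K ^ m) i)
    ≡⟨ ∑-combine K _ ⟩
  ∑[ a < K ] ∑[ b < K ^ m ] h (quotient (K ^ m) (combine a b))
    ≡⟨ sum-cong-≗ {K} (λ a → trans
        (sum-cong-≗ {K ^ m} λ b → cong (h ∘ proj₁) (remQuot-combine a b))
        (∑-const (K ^ m) (h a))) ⟩
  ∑[ a < K ] (K ^ m * h a)
    ≡⟨ sym (*-distribˡ-sum (K ^ m) h) ⟩
  K ^ m * sum h ∎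
  where open ≡-Reasoning
∑-finToFun {K} (suc m) (Fin.suc j) h = begin
  ∑[ i < K * K ^ suc m ] h (finToFun (remainder {K} (K ^ suc m) i) j)
    ≡⟨ ∑-combine K _ ⟩
  ∑[ a < K ] ∑[ b < K ^ suc m ] h (finToFun (remainder {K} (K ^ suc m) (combine a b)) j)
    ≡⟨ sum-cong-≗ {K} (λ a →
        sum-cong-≗ {K ^ suc m} λ b →
        cong (λ i → h (finToFun (proj₂ i) j)) (remQuot-combine a b)) ⟩
  ∑[ a < K ] ∑[ b < K ^ suc m ] h (finToFun b j)
    ≡⟨ sum-cong-≗ {K} (λ _ → ∑-finToFun m j h) ⟩
  ∑[ a < K ] (K ^ m * sum h)
    ≡⟨ ∑-const K _ ⟩
  K * (K ^ m * sum h)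
    ≡⟨ sym (*-assoc K (K ^ m) (sum h)) ⟩
  K ^ suc m * sum h ∎
  where open ≡-Reasoning

-- Elementary inequalities

bernoulli : ∀ a y k → a ^ k * (a + suc k * y) ≤ (a + y) ^ suc k
bernoulli a y zero    = ≤-reflexive (solve 2 (λ a y → con 1 :* (a :+ (con 1 :* y)) := (a :+ y) :* con 1) refl a y)
  where open +-*-Solver
bernoulli a y (suc k) = begin
  a ^ suc k * (a + suc (suc k) * y)
    ≤⟨ m≤m+n _ (a ^ k * (suc k * y * y)) ⟩
  a ^ suc k * (a + suc (suc k) * y) + a ^ k * (suc k * y * y)
    ≡⟨ solve 4 (λ a y k p → (a :* p) :* (a :+ (con 2 :+ k) :* y) :+ p :* ((con 1 :+ k) :* y :* y)
        := (a :+ y) :* (p :* (a :+ (con 1 :+ k) :* y))) refl a y k (a ^ k) ⟩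
  (a + y) * (a ^ k * (a + suc k * y))
    ≤⟨ *-monoʳ-≤ (a + y) (bernoulli a y k) ⟩
  (a + y) ^ suc (suc k) ∎
  where
  open ≤-Reasoning
  open +-*-Solver

6*a^n≤[a+y]^n : ∀ a y k → 5 * a ≤ suc k * y → 6 * a ^ suc k ≤ (a + y) ^ suc k
6*a^n≤[a+y]^n a y k 5a≤ny = begin
  6 * a ^ suc k           ≡⟨ solve 2 (λ a p → con 6 :* (a :* p) := p :* (a :+ con 5 :* a)) refl a (a ^ k) ⟩
  a ^ k * (a + 5 * a)     ≤⟨ *-monoʳ-≤ (a ^ k) (+-monoʳ-≤ a 5a≤ny) ⟩
  a ^ k * (a + suc k * y) ≤⟨ bernoulli a y k ⟩
  (a + y) ^ suc k         ∎
  where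
  open ≤-Reasoning
  open +-*-Solver

[A+z]^b≤2*A^b : ∀ A z b → 0 < A + z → 2 * b * z ≤ A + z → (A + z) ^ b ≤ 2 * A ^ b
[A+z]^b≤2*A^b A z b 0<K 2bz≤K = *-cancelʳ-≤ (K ^ b) (2 * A ^ b) K {{ℕ.>-nonZero 0<K}} (+-cancelʳ-≤ (K ^ b * K) _ _ (begin
  K ^ b * K + K ^ b * K
    ≡⟨ solve 2 (λ K p → p :* K :+ p :* K := con 2 :* (p :* K)) refl K (K ^ b) ⟩
  2 * (K ^ b * K)
    ≤⟨ *-monoʳ-≤ 2 (telescope b) ⟩
  2 * (K * A ^ b + b * z * K ^ b)
    ≡⟨ solve 5 (λ K q b z p → con 2 :* (K :* q :+ b :* z :* p) := con 2 :* K :* q :+ (con 2 :* b :* z) :* p) refl K (A ^ b) b z (K ^ b) ⟩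
  2 * K * A ^ b + 2 * b * z * K ^ b
    ≤⟨ +-monoʳ-≤ (2 * K * A ^ b) (*-monoˡ-≤ (K ^ b) 2bz≤K) ⟩
  2 * K * A ^ b + K * K ^ b
    ≡⟨ solve 3 (λ K q p → con 2 :* K :* q :+ K :* p := con 2 :* q :* K :+ p :* K) refl K (A ^ b) (K ^ b) ⟩
  2 * A ^ b * K + K ^ b * K ∎))
  where
  open +-*-Solver
  open ≤-Reasoning
  K : ℕ
  K = A + z
  -- K^b - A^b ≤ b z K^(b-1), multiplied by K to avoid subtraction.
  telescope : ∀ b → K ^ b * K ≤ K * A ^ b + b * z * K ^ b
  telescope zero    = ≤-reflexive (solve 2 (λ A z → con 1 :* (A :+ z) := (A :+ z) :* con 1 :+ con 0 :* z :* con 1) refl A z)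
  telescope (suc b) = begin
    K ^ suc b * K
      ≡⟨ solve 2 (λ K p → (K :* p) :* K := K :* (p :* K)) refl K (K ^ b) ⟩
    K * (K ^ b * K)
      ≤⟨ *-monoʳ-≤ K (telescope b) ⟩
    K * (K * A ^ b + b * z * K ^ b)
      ≡⟨ solve 5 (λ A z b p q → (A :+ z) :* ((A :+ z) :* q :+ b :* z :* p)
          := (A :+ z) :* (A :* q) :+ (b :* z :* ((A :+ z) :* p) :+ z :* (A :+ z) :* q)) refl A z b (K ^ b) (A ^ b) ⟩
    K * (A * A ^ b) + (b * z * (K * K ^ b) + z * K * A ^ b)
      ≤⟨ +-monoʳ-≤ (K * (A * A ^ b)) (+-monoʳ-≤ (b * z * (K * K ^ b)) (*-monoʳ-≤ (z * K) (^-monoˡ-≤ b (m≤m+n A z)))) ⟩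
    K * (A * A ^ b) + (b * z * (K * K ^ b) + z * K * K ^ b)
      ≡⟨ solve 5 (λ A z b p q → (A :+ z) :* (A :* q) :+ (b :* z :* ((A :+ z) :* p) :+ z :* (A :+ z) :* p)
          := (A :+ z) :* (A :* q) :+ (con 1 :+ b) :* z :* ((A :+ z) :* p)) refl A z b (K ^ b) (A ^ b) ⟩
    K * A ^ suc b + suc b * z * K ^ suc b ∎

[x*y]^n≡x^n*y^n : ∀ x y n → (x * y) ^ n ≡ x ^ n * y ^ n
[x*y]^n≡x^n*y^n x y zero    = refl
[x*y]^n≡x^n*y^n x y (suc n) = trans (cong ((x * y) *_) ([x*y]^n≡x^n*y^n x y n))
  (solve 4 (λ x y p q → (x :* y) :* (p :* q) := (x :* p) :* (y :* q)) refl x y (x ^ n) (y ^ n))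
  where open +-*-Solver

K^r≤2^w*A^r : ∀ {K A b} w r e → 0 < K → A ≤ K → K ^ b ≤ 2 * A ^ b → r + e ≡ b * w → K ^ r ≤ 2 ^ w * A ^ r
K^r≤2^w*A^r {K} {A} {b} w r e 0<K A≤K K^b≤2A^b r+e≡bw =
  *-cancelʳ-≤ (K ^ r) (2 ^ w * A ^ r) (K ^ e) {{m^n≢0 K e {{ℕ.>-nonZero 0<K}}}} (begin
  K ^ r * K ^ e               ≡⟨ sym (^-distribˡ-+-* K r e) ⟩
  K ^ (r + e)                 ≡⟨ cong (K ^_) r+e≡bw ⟩
  K ^ (b * w)                 ≡⟨ sym (^-*-assoc K b w) ⟩
  (K ^ b) ^ w                 ≤⟨ ^-monoˡ-≤ w K^b≤2A^b ⟩
  (2 * A ^ b) ^ w             ≡⟨ [x*y]^n≡x^n*y^n 2 (A ^ b) w ⟩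
  2 ^ w * (A ^ b) ^ w         ≡⟨ cong (2 ^ w *_) (trans (^-*-assoc A b w) (cong (A ^_) (sym r+e≡bw))) ⟩
  2 ^ w * A ^ (r + e)         ≡⟨ cong (2 ^ w *_) (^-distribˡ-+-* A r e) ⟩
  2 ^ w * (A ^ r * A ^ e)     ≤⟨ *-monoʳ-≤ (2 ^ w) (*-monoʳ-≤ (A ^ r) (^-monoˡ-≤ e A≤K)) ⟩
  2 ^ w * (A ^ r * K ^ e)     ≡⟨ sym (*-assoc (2 ^ w) _ _) ⟩
  2 ^ w * A ^ r * K ^ e       ∎)
  where open ≤-Reasoning

2^⌊log₂n⌋≤n : ∀ n → 1 ≤ n → 2 ^ ⌊log₂ n ⌋ ≤ n
2^⌊log₂n⌋≤n n 1≤n = go _ n refl 1≤n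
  where
  2*⌊n/2⌋≤n : ∀ n → 2 * ⌊ n /2⌋ ≤ n
  2*⌊n/2⌋≤n zero          = z≤n
  2*⌊n/2⌋≤n (suc zero)    = z≤n
  2*⌊n/2⌋≤n (suc (suc n)) = s≤s (≤-trans (≤-reflexive (+-suc ⌊ n /2⌋ _)) (s≤s (2*⌊n/2⌋≤n n)))
  go : ∀ k n → ⌊log₂ n ⌋ ≡ k → 1 ≤ n → 2 ^ k ≤ n
  go zero    n             _   1≤n = 1≤n
  go (suc k) (suc zero)    ()  _
  go (suc k) (suc (suc n)) log≡ _  = begin
    2 * 2 ^ k
      ≤⟨ *-monoʳ-≤ 2 (go k ⌊ suc (suc n) /2⌋ (trans (⌊log₂⌊n/2⌋⌋≡⌊log₂n⌋∸1 (suc (suc n))) (cong (_∸ 1) log≡))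
                            (s≤s z≤n)) ⟩
    2 * ⌊ suc (suc n) /2⌋
      ≤⟨ 2*⌊n/2⌋≤n (suc (suc n)) ⟩
    suc (suc n) ∎
    where open ≤-Reasoning

8≤⌊log₂n⌋ : ∀ {n} → 256 ≤ n → 8 ≤ ⌊log₂ n ⌋
8≤⌊log₂n⌋ {n} 256≤n = subst (_≤ ⌊log₂ n ⌋) (⌊log₂[2^n]⌋≡n 8) (⌊log₂⌋-mono-≤ 256≤n)

last-satisfying : ∀ (P : ℕ → Set) → (∀ b → Dec (P b)) → P 1 → ∀ n → ¬ P (suc n) → ∃[ b ] (1 ≤ b × P b × ¬ P (suc b))
last-satisfying P P? P1 zero    ¬P = ⊥-elim (¬P P1)
last-satisfying P P? P1 (suc n) ¬P with P? (suc n)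
... | yes p  = suc n , s≤s z≤n , p , ¬P
... | no ¬p  = last-satisfying P P? P1 n ¬p

S*S≤4*U : ∀ S U → 2 ≤ S → 2 * U + S ≡ S * S → S * S ≤ 4 * U
S*S≤4*U S U 2≤S 2U+S≡S*S = +-cancelʳ-≤ (2 * S) (S * S) (4 * U) (begin
  S * S + 2 * S
    ≤⟨ +-monoʳ-≤ (S * S) (*-monoˡ-≤ S 2≤S) ⟩
  S * S + S * S
    ≡⟨ cong₂ _+_ (sym 2U+S≡S*S) (sym 2U+S≡S*S) ⟩
  (2 * U + S) + (2 * U + S)
    ≡⟨ solve 2 (λ u s → (con 2 :* u :+ s) :+ (con 2 :* u :+ s) := con 4 :* u :+ con 2 :* s) refl U S ⟩
  4 * U + 2 * S ∎)
  where
  open ≤-Reasoning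
  open +-*-Solver

-- Read s as the separated pairs among C = n(n-1)/2, U as pairs that cannot be separated, and
-- n = 4bS: then U ≥ S²/4 = n²/(64b²) > (p/d) C forces s < (1 - p/d) C.
s*d+p*C<d*C : ∀ {s U C S n b p d} → s + U ≤ C → 2 * U + S ≡ S * S → 2 * C + n ≡ n * n → 4 * b * S ≡ n →
              64 * p * b * b ≤ d → 1 ≤ p → 2 ≤ S → 1 ≤ n → s * d + p * C < d * C
s*d+p*C<d*C {s} {U} {C} {S} {n} {b} {p} {d} s+U≤C 2U+S≡S*S 2C+n≡n*n 4bS≡n 64pbb≤d 1≤p 2≤S 1≤n = begin-strict
  s * d + p * C   <⟨ +-monoʳ-< (s * d) pC<dU ⟩
  s * d + d * U   ≡⟨ solve 3 (λ s d u → s :* d :+ d :* u := d :* (s :+ u)) refl s d U ⟩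
  d * (s + U)     ≤⟨ *-monoʳ-≤ d s+U≤C ⟩
  d * C           ∎
  where
  open +-*-Solver
  open ≤-Reasoning
  2pC<dU : 2 * (p * C) < d * U
  2pC<dU = begin-strict
    2 * (p * C)
      ≡⟨ solve 2 (λ p c → con 2 :* (p :* c) := p :* (con 2 :* c)) refl p C ⟩
    p * (2 * C)
      <⟨ m<m+n (p * (2 * C)) (*-mono-≤ 1≤p 1≤n) ⟩
    p * (2 * C) + p * n
      ≡⟨ trans (sym (*-distribˡ-+ p (2 * C) n)) (cong (p *_) 2C+n≡n*n) ⟩
    p * (n * n)
      ≡⟨ cong (λ k → p * (k * k)) (sym 4bS≡n) ⟩
    p * ((4 * b * S) * (4 * b * S))
      ≡⟨ solve 3 (λ p b s → p :* ((con 4 :* b :* s) :* (con 4 :* b :* s)) := con 16 :* p :* b :* b :* (s :* s)) refl p b S ⟩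
    16 * p * b * b * (S * S)
      ≤⟨ *-monoʳ-≤ (16 * p * b * b) (S*S≤4*U S U 2≤S 2U+S≡S*S) ⟩
    16 * p * b * b * (4 * U)
      ≡⟨ solve 3 (λ p b u → con 16 :* p :* b :* b :* (con 4 :* u) := (con 64 :* p :* b :* b) :* u) refl p b U ⟩
    64 * p * b * b * U
      ≤⟨ *-monoˡ-≤ U 64pbb≤d ⟩
    d * U ∎
  pC<dU : p * C < d * U
  pC<dU = ≤-<-trans (m≤n*m (p * C) 2) 2pC<dU

6*c^m≤T^m : ∀ c a T m → 1 ≤ m → c + a ≤ T → 8 * T ≤ m * a → 6 * c ^ m ≤ T ^ m
6*c^m≤T^m c a T (suc k) _ c+a≤T 8T≤ma = begin
  6 * c ^ suc k         ≤⟨ 6*a^n≤[a+y]^n c (T ∸ c) k 5c≤[1+k][T∸c] ⟩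
  (c + (T ∸ c)) ^ suc k ≡⟨ cong (_^ suc k) (m+[n∸m]≡n c≤T) ⟩
  T ^ suc k             ∎
  where
  open ≤-Reasoning
  c≤T : c ≤ T
  c≤T = ≤-trans (m≤m+n c a) c+a≤T
  5c≤[1+k][T∸c] : 5 * c ≤ suc k * (T ∸ c)
  5c≤[1+k][T∸c] = begin
    5 * c             ≤⟨ *-monoʳ-≤ 5 c≤T ⟩
    5 * T             ≤⟨ *-monoˡ-≤ T (s≤s (s≤s (s≤s (s≤s (s≤s (z≤n {3})))))) ⟩
    8 * T             ≤⟨ 8T≤ma ⟩
    suc k * a         ≤⟨ *-monoʳ-≤ (suc k) (m+n≤o⇒m≤o∸n a (subst (_≤ T) (+-comm c a) c+a≤T)) ⟩
    suc k * (T ∸ c)   ∎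

n≤2*n*n : ∀ n → n ≤ 2 * n * n
n≤2*n*n zero    = z≤n
n≤2*n*n (suc n) = ≤-trans (m≤n*m (suc n) 2) (m≤m*n (2 * suc n) (suc n))

n^r≤2*[n∸r]^r : ∀ n r → 1 ≤ n → 2 * r * r ≤ n → n ^ r ≤ 2 * (n ∸ r) ^ r
n^r≤2*[n∸r]^r n r 1≤n 2rr≤n = begin
  n ^ r
    ≡⟨ cong (_^ r) (sym [n∸r]+r≡n) ⟩
  ((n ∸ r) + r) ^ r
    ≤⟨ [A+z]^b≤2*A^b (n ∸ r) r r (subst (0 <_) (sym [n∸r]+r≡n) 1≤n) (subst (2 * r * r ≤_) (sym [n∸r]+r≡n) 2rr≤n) ⟩
  2 * (n ∸ r) ^ r ∎
  where
  open ≤-Reasoning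
  r≤n : r ≤ n
  r≤n = ≤-trans (n≤2*n*n r) 2rr≤n
  [n∸r]+r≡n : (n ∸ r) + r ≡ n
  [n∸r]+r≡n = m∸n+n≡m r≤n

8*K^r≤2^ℓ*A^r : ∀ {K A b} r ℓ → 0 < K → A ≤ K → 1 ≤ b → K ^ b ≤ 2 * A ^ b → 2 * r < ℓ * b → 7 ≤ ℓ →
                8 * K ^ r ≤ 2 ^ ℓ * A ^ r
8*K^r≤2^ℓ*A^r {K} {A} {b} r ℓ 0<K A≤K 1≤b K^b≤2A^b 2r<ℓb 7≤ℓ = begin
  8 * K ^ r                ≤⟨ *-monoʳ-≤ 8 (K^r≤2^w*A^r {b = b} (suc q) r (b ∸ rem) 0<K A≤K K^b≤2A^b r+[b∸rem]≡b*[1+q]) ⟩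
  8 * (2 ^ suc q * A ^ r)  ≡⟨ sym (*-assoc 8 (2 ^ suc q) (A ^ r)) ⟩
  8 * 2 ^ suc q * A ^ r    ≡⟨ cong (_* A ^ r) (trans (*-comm 8 (2 ^ suc q)) (sym (^-distribˡ-+-* 2 (suc q) 3))) ⟩
  2 ^ (suc q + 3) * A ^ r  ≤⟨ *-monoˡ-≤ (A ^ r) (^-monoʳ-≤ 2 q+4≤ℓ) ⟩
  2 ^ ℓ * A ^ r            ∎
  where
  open +-*-Solver
  open ≤-Reasoning
  instance
    b≢0 : NonZero b
    b≢0 = ℕ.>-nonZero 1≤b
  q rem : ℕ
  q   = r ℕ./ b
  rem = r ℕ.% b
  r≡rem+q*b : r ≡ rem + q * b
  r≡rem+q*b = m≡m%n+[m/n]*n r b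
  r+[b∸rem]≡b*[1+q] : r + (b ∸ rem) ≡ b * suc q
  r+[b∸rem]≡b*[1+q] = begin-equality
    r + (b ∸ rem)           ≡⟨ cong (_+ (b ∸ rem)) r≡rem+q*b ⟩
    rem + q * b + (b ∸ rem) ≡⟨ solve 3 (λ x y z → x :+ y :+ z := y :+ (x :+ z)) refl rem (q * b) (b ∸ rem) ⟩
    q * b + (rem + (b ∸ rem)) ≡⟨ cong (q * b +_) (m+[n∸m]≡n (<⇒≤ (m%n<n r b))) ⟩
    q * b + b               ≡⟨ solve 2 (λ q b → q :* b :+ b := b :* (con 1 :+ q)) refl q b ⟩
    b * suc q               ∎
  2q<ℓ : 2 * q < ℓ
  2q<ℓ = *-cancelʳ-< b (2 * q) ℓ (begin-strict
    2 * q * b     ≡⟨ *-assoc 2 q b ⟩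
    2 * (q * b)   ≤⟨ *-monoʳ-≤ 2 (≤-trans (m≤n+m (q * b) rem) (≤-reflexive (sym r≡rem+q*b))) ⟩
    2 * r         <⟨ 2r<ℓb ⟩
    ℓ * b         ∎)
  q+4≤ℓ : suc q + 3 ≤ ℓ
  q+4≤ℓ = *-cancelˡ-≤ 2 (begin
    2 * (suc q + 3)   ≡⟨ solve 1 (λ q → con 2 :* ((con 1 :+ q) :+ con 3) := (con 1 :+ con 2 :* q) :+ con 7) refl q ⟩
    suc (2 * q) + 7   ≤⟨ +-mono-≤ 2q<ℓ 7≤ℓ ⟩
    ℓ + ℓ             ≡⟨ solve 1 (λ l → l :+ l := con 2 :* l) refl ℓ ⟩
    2 * ℓ             ∎)

2*r<ℓ*b : ∀ {p d} r ℓ b → 1 ≤ b → 1 ≤ ℓ → 1024 * p * (r * r) < ℓ * d → d < 64 * p * suc b * suc b → 2 * r < ℓ * b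
2*r<ℓ*b {p} {d} r ℓ b 1≤b 1≤ℓ 1024prr<ℓd d<64p[1+b]² = ≰⇒> λ ℓb≤2r → <-irrefl refl (<-≤-trans 16rr<ℓ[1+b]² (begin
  ℓ * (suc b * suc b)
    ≤⟨ *-monoʳ-≤ ℓ (*-mono-≤ 1+b≤2b 1+b≤2b) ⟩
  ℓ * ((2 * b) * (2 * b))
    ≤⟨ *-monoˡ-≤ ((2 * b) * (2 * b)) (m≤m*n ℓ ℓ {{ℕ.>-nonZero 1≤ℓ}}) ⟩
  (ℓ * ℓ) * ((2 * b) * (2 * b))
    ≡⟨ solve 2 (λ l b → (l :* l) :* ((con 2 :* b) :* (con 2 :* b)) := con 4 :* ((l :* b) :* (l :* b))) refl ℓ b ⟩
  4 * ((ℓ * b) * (ℓ * b))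
    ≤⟨ *-monoʳ-≤ 4 (*-mono-≤ ℓb≤2r ℓb≤2r) ⟩
  4 * ((2 * r) * (2 * r))
    ≡⟨ solve 1 (λ r → con 4 :* ((con 2 :* r) :* (con 2 :* r)) := con 16 :* (r :* r)) refl r ⟩
  16 * (r * r) ∎))
  where
  open +-*-Solver
  open ≤-Reasoning
  1+b≤2b : suc b ≤ 2 * b
  1+b≤2b = ≤-trans (+-monoˡ-≤ b 1≤b) (≤-reflexive (solve 1 (λ b → b :+ b := con 2 :* b) refl b))
  16rr<ℓ[1+b]² : 16 * (r * r) < ℓ * (suc b * suc b)
  16rr<ℓ[1+b]² = *-cancelˡ-< (64 * p) (16 * (r * r)) (ℓ * (suc b * suc b)) (begin-strict
    64 * p * (16 * (r * r))
      ≡⟨ solve 2 (λ p q → con 64 :* p :* (con 16 :* q) := con 1024 :* p :* q) refl p (r * r) ⟩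
    1024 * p * (r * r)
      <⟨ 1024prr<ℓd ⟩
    ℓ * d
      ≤⟨ *-monoʳ-≤ ℓ (<⇒≤ d<64p[1+b]²) ⟩
    ℓ * (64 * p * suc b * suc b)
      ≡⟨ solve 3 (λ l p c → l :* (con 64 :* p :* c :* c) := con 64 :* p :* (l :* (c :* c))) refl ℓ p (suc b) ⟩
    64 * p * (ℓ * (suc b * suc b)) ∎)

isqrt-bracket : ∀ {p d} → 1 ≤ p → 64 * p ≤ d → ∃[ b ] (1 ≤ b × 64 * p * b * b ≤ d × d < 64 * p * suc b * suc b)
isqrt-bracket {p} {d} 1≤p 64p≤d =
  let (b , 1≤b , lower , ¬upper) = last-satisfying (λ b → 64 * p * b * b ≤ d) (λ b → 64 * p * b * b ≤? d) P1 d ¬P[1+d]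
  in b , 1≤b , lower , ≰⇒> ¬upper
  where
  P1 : 64 * p * 1 * 1 ≤ d
  P1 = subst (_≤ d) (sym (trans (*-identityʳ (64 * p * 1)) (*-identityʳ (64 * p)))) 64p≤d
  ¬P[1+d] : ¬ (64 * p * suc d * suc d ≤ d)
  ¬P[1+d] P = <-irrefl refl (<-≤-trans (n<1+n d) (≤-trans 1+d≤64p[1+d]² P))
    where
    1+d≤64p[1+d]² : suc d ≤ 64 * p * suc d * suc d
    1+d≤64p[1+d]² = ≤-trans (m≤n*m (suc d) (64 * p) {{ℕ.>-nonZero (≤-trans 1≤p (m≤n*m p 64))}}) (m≤m*n (64 * p * suc d) (suc d))

-- Rationals

ℕ→ℚ≡mkℚ : ∀ k → ℕ→ℚ k ≡ mkℚ (ℤ.+ k) 0 (Coprime.sym (1-coprimeTo k))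
ℕ→ℚ≡mkℚ k = ℚP.normalize-coprime (Coprime.sym (1-coprimeTo k))

ℕ→ℚ-+ : ∀ a b → ℕ→ℚ (a + b) ≡ ℕ→ℚ a +ℚ ℕ→ℚ b
ℕ→ℚ-+ a b rewrite ℕ→ℚ≡mkℚ a | ℕ→ℚ≡mkℚ b =
  cong (_/ 1) (sym (cong₂ ℤ._+_ (ℤP.*-identityʳ (ℤ.+ a)) (ℤP.*-identityʳ (ℤ.+ b))))

ℕ→ℚ-* : ∀ a b → ℕ→ℚ (a * b) ≡ ℕ→ℚ a *ℚ ℕ→ℚ b
ℕ→ℚ-* a b rewrite ℕ→ℚ≡mkℚ a | ℕ→ℚ≡mkℚ b = cong (_/ 1) (ℤP.pos-* a b)

ℕ→ℚ-mono-≤ : ∀ {a b} → a ≤ b → ℕ→ℚ a ≤ℚ ℕ→ℚ b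
ℕ→ℚ-mono-≤ {a} {b} a≤b rewrite ℕ→ℚ≡mkℚ a | ℕ→ℚ≡mkℚ b =
  *≤* (subst₂ ℤ._≤_ (sym (ℤP.*-identityʳ (ℤ.+ a))) (sym (ℤP.*-identityʳ (ℤ.+ b))) (ℤ.+≤+ a≤b))

ℕ→ℚ-mono-< : ∀ {a b} → a < b → ℕ→ℚ a <ℚ ℕ→ℚ b
ℕ→ℚ-mono-< {a} {b} a<b rewrite ℕ→ℚ≡mkℚ a | ℕ→ℚ≡mkℚ b =
  *<* (subst₂ ℤ._<_ (sym (ℤP.*-identityʳ (ℤ.+ a))) (sym (ℤP.*-identityʳ (ℤ.+ b))) (ℤ.+<+ a<b))

ℕ→ℚ-cancel-≤ : ∀ {a b} → ℕ→ℚ a ≤ℚ ℕ→ℚ b → a ≤ b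
ℕ→ℚ-cancel-≤ a≤b = ≮⇒≥ λ b<a → ℚP.<-irrefl refl (ℚP.<-≤-trans (ℕ→ℚ-mono-< b<a) a≤b)

ℕ→ℚ-cancel-< : ∀ {a b} → ℕ→ℚ a <ℚ ℕ→ℚ b → a < b
ℕ→ℚ-cancel-< a<b = ≰⇒> λ b≤a → ℚP.<-irrefl refl (ℚP.<-≤-trans a<b (ℕ→ℚ-mono-≤ b≤a))

ℕ→ℚ-nonNegative : ∀ n → ℚ.NonNegative (ℕ→ℚ n)
ℕ→ℚ-nonNegative n = ℚ.nonNegative (ℕ→ℚ-mono-≤ {0} {n} z≤n)

ℕ→ℚ-positive : ∀ n .{{_ : NonZero n}} → ℚ.Positive (ℕ→ℚ n)
ℕ→ℚ-positive n = ℚ.positive (ℕ→ℚ-mono-< (ℕ.>-nonZero⁻¹ n))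

1/n*n≡1 : ∀ n .{{_ : NonZero n}} → ℤ.+ 1 / n *ℚ ℕ→ℚ n ≡ 1ℚ
1/n*n≡1 (suc n) rewrite ℕ→ℚ≡mkℚ (suc n) | ℚP.normalize-coprime {1} {n} (1-coprimeTo (suc n)) =
  ℚP.*-inverseˡ (mkℚ (ℤ.+ suc n) 0 (Coprime.sym (1-coprimeTo (suc n))))

1/_! : ℕ → ℚ
1/ k ! = (ℤ.+ 1 / k !) {{k !≢0}}

1/k!*k!≡1 : ∀ k → 1/ k ! *ℚ ℕ→ℚ (k !) ≡ 1ℚ
1/k!*k!≡1 k = 1/n*n≡1 (k !) {{k !≢0}}

1/[1+k]!+1/[1+k]!≤1/k! : ∀ k → 1 ≤ k → 1/ suc k ! +ℚ 1/ suc k ! ≤ℚ 1/ k !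
1/[1+k]!+1/[1+k]!≤1/k! k 1≤k = ℚP.*-cancelʳ-≤-pos (ℕ→ℚ (suc k !)) {{ℕ→ℚ-positive (suc k !) {{suc k !≢0}}}} (begin
  (1/ suc k ! +ℚ 1/ suc k !) *ℚ ℕ→ℚ (suc k !)
    ≡⟨ ℚP.*-distribʳ-+ (ℕ→ℚ (suc k !)) (1/ suc k !) (1/ suc k !) ⟩
  1/ suc k ! *ℚ ℕ→ℚ (suc k !) +ℚ 1/ suc k ! *ℚ ℕ→ℚ (suc k !)
    ≡⟨ cong₂ _+ℚ_ (1/k!*k!≡1 (suc k)) (1/k!*k!≡1 (suc k)) ⟩
  ℕ→ℚ 2
    ≤⟨ ℕ→ℚ-mono-≤ (s≤s 1≤k) ⟩
  ℕ→ℚ (suc k)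
    ≡⟨ sym (ℚP.*-identityˡ _) ⟩
  1ℚ *ℚ ℕ→ℚ (suc k)
    ≡⟨ cong (_*ℚ ℕ→ℚ (suc k)) (sym (1/k!*k!≡1 k)) ⟩
  1/ k ! *ℚ ℕ→ℚ (k !) *ℚ ℕ→ℚ (suc k)
    ≡⟨ solve 3 (λ x y z → (x :* y) :* z := x :* (z :* y)) refl (1/ k !) (ℕ→ℚ (k !)) (ℕ→ℚ (suc k)) ⟩
  1/ k ! *ℚ (ℕ→ℚ (suc k) *ℚ ℕ→ℚ (k !))
    ≡⟨ cong (1/ k ! *ℚ_) (sym (ℕ→ℚ-* (suc k) (k !))) ⟩
  1/ k ! *ℚ ℕ→ℚ (suc k !) ∎)
  where
  open ℚP.≤-Reasoning
  open ℚ-Solver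

eSum+1/[1+N]!≤3 : ∀ N → eSum (suc N) +ℚ 1/ suc N ! ≤ℚ ℕ→ℚ 3
eSum+1/[1+N]!≤3 zero    = ℚP.≤-refl
eSum+1/[1+N]!≤3 (suc N) = begin
  eSum (suc N) +ℚ 1/ suc (suc N) ! +ℚ 1/ suc (suc N) !
    ≡⟨ ℚP.+-assoc (eSum (suc N)) _ _ ⟩
  eSum (suc N) +ℚ (1/ suc (suc N) ! +ℚ 1/ suc (suc N) !)
    ≤⟨ ℚP.+-monoʳ-≤ (eSum (suc N)) (1/[1+k]!+1/[1+k]!≤1/k! (suc N) (s≤s z≤n)) ⟩
  eSum (suc N) +ℚ 1/ suc N !
    ≤⟨ eSum+1/[1+N]!≤3 N ⟩
  ℕ→ℚ 3 ∎
  where open ℚP.≤-Reasoning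

eSum≤3 : ∀ N → eSum N ≤ℚ ℕ→ℚ 3
eSum≤3 zero    = ℕ→ℚ-mono-≤ {1} {3} (s≤s z≤n)
eSum≤3 (suc N) = begin
  eSum (suc N)
    ≡⟨ sym (ℚP.+-identityʳ (eSum (suc N))) ⟩
  eSum (suc N) +ℚ 0ℚ
    ≤⟨ ℚP.+-monoʳ-≤ (eSum (suc N)) (ℚP.nonNegative⁻¹ (1/ suc N !) {{ℚP.normalize-nonNeg 1 (suc N !) {{suc N !≢0}}}}) ⟩
  eSum (suc N) +ℚ 1/ suc N !
    ≤⟨ eSum+1/[1+N]!≤3 N ⟩
  ℕ→ℚ 3 ∎
  where open ℚP.≤-Reasoning

ExceedsOverE⇒<3* : ∀ {a g T} → ExceedsOverE a g T → a * T < 3 * g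
ExceedsOverE⇒<3* {a} {g} {T} (N , aT<g*e) = ℕ→ℚ-cancel-< {a * T} {3 * g} (begin-strict
  ℕ→ℚ (a * T)        <⟨ aT<g*e ⟩
  ℕ→ℚ g *ℚ eSum N    ≤⟨ ℚP.*-monoˡ-≤-nonNeg (ℕ→ℚ g) {{ℕ→ℚ-nonNegative g}} (eSum≤3 N) ⟩
  ℕ→ℚ g *ℚ ℕ→ℚ 3     ≡⟨ sym (ℕ→ℚ-* g 3) ⟩
  ℕ→ℚ (g * 3)        ≡⟨ cong ℕ→ℚ (*-comm g 3) ⟩
  ℕ→ℚ (3 * g)        ∎)
  where open ℚP.≤-Reasoning

mkℚ*↧≡↥ : ∀ p dm .(c : Coprime p (suc dm)) → mkℚ (ℤ.+ p) dm c *ℚ ℕ→ℚ (suc dm) ≡ ℕ→ℚ p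
mkℚ*↧≡↥ p dm c = ℚP.toℚᵘ-injective (begin
  toℚᵘ (mkℚ (ℤ.+ p) dm c *ℚ ℕ→ℚ (suc dm))        ≈⟨ ℚP.toℚᵘ-homo-* (mkℚ (ℤ.+ p) dm c) (ℕ→ℚ (suc dm)) ⟩
  mkℚᵘ (ℤ.+ p) dm ℚᵘ.* toℚᵘ (ℕ→ℚ (suc dm))       ≡⟨ cong (λ q → mkℚᵘ (ℤ.+ p) dm ℚᵘ.* toℚᵘ q) (ℕ→ℚ≡mkℚ (suc dm)) ⟩
  mkℚᵘ (ℤ.+ p) dm ℚᵘ.* mkℚᵘ (ℤ.+ suc dm) 0       ≈⟨ ℚᵘ.*≡* cross-multiplied ⟩
  mkℚᵘ (ℤ.+ p) 0                                 ≡⟨ cong toℚᵘ (sym (ℕ→ℚ≡mkℚ p)) ⟩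
  toℚᵘ (ℕ→ℚ p)                                   ∎)
  where
  open ℚᵘP.≃-Reasoning
  cross-multiplied : (ℤ.+ p ℤ.* ℤ.+ suc dm) ℤ.* ℤ.+ 1 ≡ ℤ.+ p ℤ.* ℤ.+ (suc dm * 1)
  cross-multiplied = trans (ℤP.*-identityʳ _) (cong (λ k → ℤ.+ p ℤ.* ℤ.+ k) (sym (*-identityʳ (suc dm))))

record SmallFraction (ε : ℚ) : Set where
  field
    num den    : ℕ
    ε*den≡num  : ε *ℚ ℕ→ℚ den ≡ ℕ→ℚ num
    1≤num      : 1 ≤ num
    64*num≤den : 64 * num ≤ den

smallFraction : ∀ {ε} → 0ℚ <ℚ ε → ε ≤ℚ ℤ.+ 1 / 64 → SmallFraction ε
smallFraction {mkℚ (ℤ.+ p) dm c} 0<ε ε≤1/64 = record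
  { num = p ; den = suc dm ; ε*den≡num = ε*d≡p ; 1≤num = 1≤p ; 64*num≤den = 64p≤d }
  where
  ε d : ℚ
  ε = mkℚ (ℤ.+ p) dm c
  d = ℕ→ℚ (suc dm)
  ε*d≡p : ε *ℚ d ≡ ℕ→ℚ p
  ε*d≡p = mkℚ*↧≡↥ p dm c
  1≤p : 1 ≤ p
  1≤p = ℕ→ℚ-cancel-< {0} {p} (subst₂ _<ℚ_ (ℚP.*-zeroˡ d) ε*d≡p (ℚP.*-monoˡ-<-pos d {{ℕ→ℚ-positive (suc dm)}} 0<ε))
  64p≤d : 64 * p ≤ suc dm
  64p≤d = ℕ→ℚ-cancel-≤ (begin
    ℕ→ℚ (64 * p)                    ≡⟨ trans (ℕ→ℚ-* 64 p) (cong (ℕ→ℚ 64 *ℚ_) (sym ε*d≡p)) ⟩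
    ℕ→ℚ 64 *ℚ (ε *ℚ d)              ≡⟨ solve 3 (λ s e d → s :* (e :* d) := e :* (s :* d)) refl (ℕ→ℚ 64) ε d ⟩
    ε *ℚ (ℕ→ℚ 64 *ℚ d)              ≡⟨ cong (ε *ℚ_) (sym (ℕ→ℚ-* 64 (suc dm))) ⟩
    ε *ℚ ℕ→ℚ (64 * suc dm)          ≤⟨ ℚP.*-monoʳ-≤-nonNeg (ℕ→ℚ (64 * suc dm)) {{ℕ→ℚ-nonNegative (64 * suc dm)}} ε≤1/64 ⟩
    ℤ.+ 1 / 64 *ℚ ℕ→ℚ (64 * suc dm) ≡⟨ cong (ℤ.+ 1 / 64 *ℚ_) (ℕ→ℚ-* 64 (suc dm)) ⟩
    ℤ.+ 1 / 64 *ℚ (ℕ→ℚ 64 *ℚ d)     ≡⟨ sym (ℚP.*-assoc (ℤ.+ 1 / 64) (ℕ→ℚ 64) d) ⟩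
    ℤ.+ 1 / 64 *ℚ ℕ→ℚ 64 *ℚ d       ≡⟨ trans (cong (_*ℚ d) (1/n*n≡1 64)) (ℚP.*-identityˡ d) ⟩
    d                               ∎)
    where
    open ℚP.≤-Reasoning
    open ℚ-Solver
smallFraction {mkℚ ℤ.-[1+ n ] dm c} (*<* ()) _

module _ {ε : ℚ} {p d : ℕ} (ε*d≡p : ε *ℚ ℕ→ℚ d ≡ ℕ→ℚ p) where

  s*d+p*C<d*C⇒s<[1-ε]*C : ∀ s C → s * d + p * C < d * C → ℕ→ℚ s <ℚ (1ℚ -ℚ ε) *ℚ ℕ→ℚ C
  s*d+p*C<d*C⇒s<[1-ε]*C s C sd+pC<dC = ℚP.≰⇒> λ [1-ε]C≤s → <⇒≱ sd+pC<dC (ℕ→ℚ-cancel-≤ (begin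
    ℕ→ℚ (d * C)
      ≡⟨ ℕ→ℚ-* d C ⟩
    ℕ→ℚ d *ℚ ℕ→ℚ C
      ≡⟨ solve 3 (λ e c d → d :* c := (con 1ℚ :- e) :* c :* d :+ (e :* d) :* c) refl ε (ℕ→ℚ C) (ℕ→ℚ d) ⟩
    (1ℚ -ℚ ε) *ℚ ℕ→ℚ C *ℚ ℕ→ℚ d +ℚ ε *ℚ ℕ→ℚ d *ℚ ℕ→ℚ C
      ≤⟨ ℚP.+-monoˡ-≤ (ε *ℚ ℕ→ℚ d *ℚ ℕ→ℚ C) (ℚP.*-monoʳ-≤-nonNeg (ℕ→ℚ d) {{ℕ→ℚ-nonNegative d}} [1-ε]C≤s) ⟩
    ℕ→ℚ s *ℚ ℕ→ℚ d +ℚ ε *ℚ ℕ→ℚ d *ℚ ℕ→ℚ C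
      ≡⟨ cong₂ (λ x y → x +ℚ y *ℚ ℕ→ℚ C) (sym (ℕ→ℚ-* s d)) ε*d≡p ⟩
    ℕ→ℚ (s * d) +ℚ ℕ→ℚ p *ℚ ℕ→ℚ C
      ≡⟨ cong (ℕ→ℚ (s * d) +ℚ_) (sym (ℕ→ℚ-* p C)) ⟩
    ℕ→ℚ (s * d) +ℚ ℕ→ℚ (p * C)
      ≡⟨ sym (ℕ→ℚ-+ (s * d) (p * C)) ⟩
    ℕ→ℚ (s * d + p * C) ∎))
    where
    open ℚP.≤-Reasoning
    open ℚ-Solver

  ε*R<ℓ/1024⇒1024*p*R<ℓ*d : .{{_ : NonZero d}} → ∀ R ℓ → ε *ℚ ℕ→ℚ R <ℚ ℤ.+ 1 / 1024 *ℚ ℕ→ℚ ℓ → 1024 * p * R < ℓ * d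
  ε*R<ℓ/1024⇒1024*p*R<ℓ*d R ℓ εR<ℓ/1024 = ℕ→ℚ-cancel-< {1024 * p * R} {ℓ * d} (begin-strict
    ℕ→ℚ (1024 * p * R)
      ≡⟨ trans (ℕ→ℚ-* (1024 * p) R) (cong (_*ℚ ℕ→ℚ R) (trans (ℕ→ℚ-* 1024 p) (cong (ℕ→ℚ 1024 *ℚ_) (sym ε*d≡p)))) ⟩
    ℕ→ℚ 1024 *ℚ (ε *ℚ ℕ→ℚ d) *ℚ ℕ→ℚ R
      ≡⟨ solve 4 (λ t e d r → t :* (e :* d) :* r := (e :* r) :* (t :* d)) refl (ℕ→ℚ 1024) ε (ℕ→ℚ d) (ℕ→ℚ R) ⟩
    ε *ℚ ℕ→ℚ R *ℚ (ℕ→ℚ 1024 *ℚ ℕ→ℚ d)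
      ≡⟨ cong (ε *ℚ ℕ→ℚ R *ℚ_) (sym (ℕ→ℚ-* 1024 d)) ⟩
    ε *ℚ ℕ→ℚ R *ℚ ℕ→ℚ (1024 * d)
      <⟨ ℚP.*-monoˡ-<-pos (ℕ→ℚ (1024 * d)) {{ℕ→ℚ-positive (1024 * d) {{m*n≢0 1024 d}}}} εR<ℓ/1024 ⟩
    ℤ.+ 1 / 1024 *ℚ ℕ→ℚ ℓ *ℚ ℕ→ℚ (1024 * d)
      ≡⟨ cong (ℤ.+ 1 / 1024 *ℚ ℕ→ℚ ℓ *ℚ_) (ℕ→ℚ-* 1024 d) ⟩
    ℤ.+ 1 / 1024 *ℚ ℕ→ℚ ℓ *ℚ (ℕ→ℚ 1024 *ℚ ℕ→ℚ d)
      ≡⟨ solve 4 (λ c l t d → c :* l :* (t :* d) := (c :* t) :* (l :* d)) refl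
                 (ℤ.+ 1 / 1024) (ℕ→ℚ ℓ) (ℕ→ℚ 1024) (ℕ→ℚ d) ⟩
    ℤ.+ 1 / 1024 *ℚ ℕ→ℚ 1024 *ℚ (ℕ→ℚ ℓ *ℚ ℕ→ℚ d)
      ≡⟨ trans (cong (_*ℚ (ℕ→ℚ ℓ *ℚ ℕ→ℚ d)) (1/n*n≡1 1024)) (ℚP.*-identityˡ _) ⟩
    ℕ→ℚ ℓ *ℚ ℕ→ℚ d
      ≡⟨ sym (ℕ→ℚ-* ℓ d) ⟩
    ℕ→ℚ (ℓ * d) ∎)
    where
    open ℚP.≤-Reasoning
    open ℚ-Solver

-- The hard instance

mergedWords : ∀ K M m → DataSet (K ^ m) m
mergedWords K M m i j = merge M (finToFun i j)

module _ {K} (M : ℕ) {m r} (s : Fin r → Fin (K ^ m)) where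

  Rejects⇒Collision : ∀ j → Rejects (mergedWords K M m) s ⁅ j ⁆ → Collision M (column {m = m} s j)
  Rejects⇒Collision j (a , b , a≢b , unseparated) with merge M (finToFun (s a) j) ℕ.≟ merge M (finToFun (s b) j)
  ... | yes eq = a , b , a≢b , eq
  ... | no neq = ⊥-elim (unseparated (j , x∈⁅x⁆ j , neq))

successWith≤∑Seq-collision^m : ∀ ε K M m r → (∀ j → Bad ε (mergedWords K M m) ⁅ j ⁆) →
               successWith ε (mergedWords K M m) r ≤ ∑Seq r K (χ ∘ collision? M) ^ m
successWith≤∑Seq-collision^m ε K M m r allBad = begin
  successWith ε (mergedWords K M m) r
    ≡⟨ length-filter-allSeqs r (K ^ m) (rejectsAllBad? ε (mergedWords K M m)) ⟩
  ∑Seq r (K ^ m) (χ ∘ rejectsAllBad? ε (mergedWords K M m))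
    ≤⟨ ∑Seq-mono-≤ r (λ s → χ≤ (rejectsAllBad? ε (mergedWords K M m) s) λ rejectsAll →
        ≤-reflexive (sym (∏Columns-χ m (collision? M) s λ j →
        Rejects⇒Collision M s j (rejectsAll ⁅ j ⁆ (allBad j))))) ⟩
  ∑Seq r (K ^ m) (∏Columns m (χ ∘ collision? M))
    ≡⟨ ∑Seq-∏Columns {r} {K} (χ-collision-ext M) m ⟩
  ∑Seq r K (χ ∘ collision? M) ^ m ∎
  where open ≤-Reasoning

module _ {ε : ℚ} {p d : ℕ} (ε*d≡p : ε *ℚ ℕ→ℚ d ≡ ℕ→ℚ p) (1≤p : 1 ≤ p) {b M K : ℕ} (1≤b : 1 ≤ b) (2≤M : 2 ≤ M)
         (K≡4bM : K ≡ 4 * b * M) (64pbb≤d : 64 * p * b * b ≤ d) where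

  mergedWords-singleton-bad : ∀ m (j : Fin m) → Bad ε (mergedWords K M m) ⁅ j ⁆
  mergedWords-singleton-bad (suc m) j =
    s*d+p*C<d*C⇒s<[1-ε]*C {ε} {p} {d} ε*d≡p (separatedPairs (mergedWords K M (suc m)) ⁅ j ⁆) (K ^ suc m C 2)
      (s*d+p*C<d*C {U = U} {S = S} {b = b} sep+U≤C (2*#pairs[P×P]+#P≡#P*#P merged?) (2*nC2+n≡n*n (K ^ suc m))
                   4bS≡K^[1+m] 64pbb≤d 1≤p 2≤S 1≤K^[1+m])
    where
    merged? : ∀ i → Dec (toℕ (finToFun {K} i j) < M)
    merged? i = toℕ (finToFun i j) <? M
    S U : ℕ
    S = ∑[ i < K ^ suc m ] χ (merged? i)
    U = #pairs (λ i i′ → merged? i ×-dec merged? i′)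
    M≤K : M ≤ K
    M≤K = subst (M ≤_) (sym K≡4bM) (m≤n*m M (4 * b) {{ℕ.>-nonZero (≤-trans 1≤b (m≤n*m b 4))}})
    0<K : 0 < K
    0<K = ≤-trans (≤-trans (s≤s z≤n) 2≤M) M≤K
    1≤K^[1+m] : 1 ≤ K ^ suc m
    1≤K^[1+m] = m^n>0 K {{ℕ.>-nonZero 0<K}} (suc m)
    S≡K^m*M : S ≡ K ^ m * M
    S≡K^m*M = trans (∑-finToFun m j (λ a → χ (toℕ a <? M))) (cong (K ^ m *_) (∑χtoℕ< K M M≤K))
    4bS≡K^[1+m] : 4 * b * S ≡ K ^ suc m
    4bS≡K^[1+m] = begin
      4 * b * S             ≡⟨ cong (4 * b *_) S≡K^m*M ⟩
      4 * b * (K ^ m * M)   ≡⟨ solve 3 (λ b m k → con 4 :* b :* (k :* m) := (con 4 :* b :* m) :* k) refl b M (K ^ m) ⟩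
      4 * b * M * K ^ m     ≡⟨ cong (_* K ^ m) (sym K≡4bM) ⟩
      K ^ suc m             ∎
      where
      open ≡-Reasoning
      open +-*-Solver
    2≤S : 2 ≤ S
    2≤S = ≤-trans 2≤M (≤-trans (m≤n*m M (K ^ m) {{m^n≢0 K m {{ℕ.>-nonZero 0<K}}}}) (≤-reflexive (sym S≡K^m*M)))
    sep+U≤C : separatedPairs (mergedWords K M (suc m)) ⁅ j ⁆ + U ≤ K ^ suc m C 2
    sep+U≤C = begin
      separatedPairs (mergedWords K M (suc m)) ⁅ j ⁆ + U
        ≤⟨ +-monoʳ-≤ (separatedPairs (mergedWords K M (suc m)) ⁅ j ⁆)
             (#pairs-mono-≤ (λ i i′ → merged? i ×-dec merged? i′)
                            (λ i i′ → ¬? (separates? ⁅ j ⁆ (mergedWords K M (suc m) i) (mergedWords K M (suc m) i′)))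
                            unseparated) ⟩
      separatedPairs (mergedWords K M (suc m)) ⁅ j ⁆
        + #pairs (λ i i′ → ¬? (separates? ⁅ j ⁆ (mergedWords K M (suc m) i) (mergedWords K M (suc m) i′)))
        ≡⟨ separatedPairs+unseparated≡nC2 (mergedWords K M (suc m)) ⁅ j ⁆ ⟩
      K ^ suc m C 2 ∎
      where
      open ≤-Reasoning
      unseparated : ∀ {i i′} → toℕ (finToFun i j) < M × toℕ (finToFun i′ j) < M →
                    ¬ Separates ⁅ j ⁆ (mergedWords K M (suc m) i) (mergedWords K M (suc m) i′)
      unseparated {i} {i′} (i<M , i′<M) (j′ , j′∈⁅j⁆ , xij′≢xi′j′) with x∈⁅y⁆⇒x≡y j j′∈⁅j⁆
      ... | refl = xij′≢xi′j′ (trans (merge-< M (finToFun i j) i<M) (sym (merge-< M (finToFun i′ j) i′<M)))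
-- M > 2r² makes every admissible r at most M, and K = 4bM makes the singletons bad.
module HardInstance {m ℓ : ℕ} (8≤ℓ : 8 ≤ ℓ) (2^ℓ≤m : 2 ^ ℓ ≤ m)
                    {ε : ℚ} {p d : ℕ} (ε*d≡p : ε *ℚ ℕ→ℚ d ≡ ℕ→ℚ p) (1≤p : 1 ≤ p)
                    {b : ℕ} (1≤b : 1 ≤ b) (64pbb≤d : 64 * p * b * b ≤ d) (d<64p[1+b]² : d < 64 * p * suc b * suc b)
                    {M K : ℕ} (M≡2+2ℓd : M ≡ 2 + 2 * ℓ * d) (K≡4bM : K ≡ 4 * b * M) where

  1≤m : 1 ≤ m
  1≤m = ≤-trans (m^n>0 2 ℓ) 2^ℓ≤m

  2≤M : 2 ≤ M
  2≤M = subst (2 ≤_) (sym M≡2+2ℓd) (s≤s (s≤s z≤n))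

  2M≤K : 2 * M ≤ K
  2M≤K = subst (2 * M ≤_) (sym K≡4bM) (*-monoˡ-≤ M (≤-trans (s≤s (s≤s (z≤n {2}))) (*-monoʳ-≤ 4 1≤b)))

  M≤K : M ≤ K
  M≤K = ≤-trans (m≤n*m M 2) 2M≤K

  0<K : 0 < K
  0<K = ≤-trans (≤-trans (s≤s z≤n) 2≤M) M≤K

  K≤K^m : K ≤ K ^ m
  K≤K^m = ≤-trans (≤-reflexive (sym (*-identityʳ K))) (^-monoʳ-≤ K {{ℕ.>-nonZero 0<K}} 1≤m)

  module _ (r : ℕ) (1024prr<ℓd : 1024 * p * (r * r) < ℓ * d) where

    2rr<M : 2 * r * r < M
    2rr<M = begin-strict
      2 * r * r
        ≡⟨ *-assoc 2 r r ⟩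
      2 * (r * r)
        ≤⟨ *-monoʳ-≤ 2 (≤-trans (m≤n*m (r * r) (1024 * p) {{ℕ.>-nonZero (*-mono-≤ (s≤s (z≤n {1023})) 1≤p)}}) (<⇒≤ 1024prr<ℓd)) ⟩
      2 * (ℓ * d)
        ≡⟨ sym (*-assoc 2 ℓ d) ⟩
      2 * ℓ * d
        <⟨ m<n+m (2 * ℓ * d) (s≤s z≤n) ⟩
      2 + 2 * ℓ * d
        ≡⟨ sym M≡2+2ℓd ⟩
      M ∎
      where open ≤-Reasoning

    r≤M : r ≤ M
    r≤M = ≤-trans (n≤2*n*n r) (<⇒≤ 2rr<M)

    A : ℕ
    A = (K ∸ M) ∸ r

    A+[M+r]≡K : A + (M + r) ≡ K
    A+[M+r]≡K = trans (cong (_+ (M + r)) (∸-+-assoc K M r))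
      (m∸n+n≡m (≤-trans (+-monoʳ-≤ M r≤M) (≤-trans (≤-reflexive (cong (M +_) (sym (+-identityʳ M)))) 2M≤K)))

    K^b≤2A^b : K ^ b ≤ 2 * A ^ b
    K^b≤2A^b = subst (λ k → k ^ b ≤ 2 * A ^ b) A+[M+r]≡K ([A+z]^b≤2*A^b A (M + r) b (subst (0 <_) (sym A+[M+r]≡K) 0<K)
      (subst (2 * b * (M + r) ≤_) (sym A+[M+r]≡K) (begin
        2 * b * (M + r) ≤⟨ *-monoʳ-≤ (2 * b) (+-monoʳ-≤ M r≤M) ⟩
        2 * b * (M + M) ≡⟨ solve 2 (λ b m → con 2 :* b :* (m :+ m) := con 4 :* b :* m) refl b M ⟩
        4 * b * M       ≡⟨ sym K≡4bM ⟩
        K               ∎)))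
      where
      open ≤-Reasoning
      open +-*-Solver

    8K^r≤mA^r : 8 * K ^ r ≤ m * A ^ r
    8K^r≤mA^r = begin
      8 * K ^ r     ≤⟨ 8*K^r≤2^ℓ*A^r r ℓ 0<K (≤-trans (m∸n≤m (K ∸ M) r) (m∸n≤m K M)) 1≤b K^b≤2A^b
                         (2*r<ℓ*b {p} {d} r ℓ b 1≤b (≤-trans (s≤s z≤n) 8≤ℓ) 1024prr<ℓd d<64p[1+b]²) (≤-trans (n≤1+n 7) 8≤ℓ) ⟩
      2 ^ ℓ * A ^ r ≤⟨ *-monoˡ-≤ (A ^ r) 2^ℓ≤m ⟩
      m * A ^ r     ∎
      where open ≤-Reasoning

    6*successWith≤[K^m]^r : 6 * successWith ε (mergedWords K M m) r ≤ (K ^ m) ^ r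
    6*successWith≤[K^m]^r = begin
      6 * successWith ε (mergedWords K M m) r
        ≤⟨ *-monoʳ-≤ 6 (successWith≤∑Seq-collision^m ε K M m r
            (mergedWords-singleton-bad {ε} {p} {d} ε*d≡p 1≤p {b} {M} {K} 1≤b 2≤M K≡4bM 64pbb≤d m)) ⟩
      6 * ∑Seq r K (χ ∘ collision? M) ^ m
        ≤⟨ 6*c^m≤T^m (∑Seq r K (χ ∘ collision? M)) (A ^ r) (K ^ r) m 1≤m
            (∑Seq-collision+[K∸M∸r]^r≤K^r M {r} {K}) 8K^r≤mA^r ⟩
      (K ^ r) ^ m
        ≡⟨ trans (^-*-assoc K r m) (trans (cong (K ^_) (*-comm r m)) (sym (^-*-assoc K m r))) ⟩
      (K ^ m) ^ r ∎
      where open ≤-Reasoning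

    [K^m]^r≤2*#injSeqs : (K ^ m) ^ r ≤ 2 * length (injSeqs r (K ^ m))
    [K^m]^r≤2*#injSeqs = ≤-trans (n^r≤2*[n∸r]^r (K ^ m) r (≤-trans 0<K K≤K^m) (≤-trans (<⇒≤ 2rr<M) (≤-trans M≤K K≤K^m)))
                                 (*-monoʳ-≤ 2 ([n∸r]^r≤#injSeqs r (K ^ m)))

  instance
    d≢0 : NonZero d
    d≢0 = ℕ.>-nonZero (≤-trans (*-mono-≤ (*-mono-≤ (*-mono-≤ (s≤s (z≤n {63})) 1≤p) 1≤b) 1≤b) 64pbb≤d)

  withReplacement : ∀ r → ExceedsOverE 1 (successWith ε (mergedWords K M m) r) ((K ^ m) ^ r) →
                    ℤ.+ 1 / 1024 *ℚ ℕ→ℚ ℓ ≤ℚ ε *ℚ ℕ→ℚ (r * r)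
  withReplacement r exceeds = ℚP.≮⇒≥ λ εrr<ℓ/1024 →
    let small = ε*R<ℓ/1024⇒1024*p*R<ℓ*d {ε} {p} {d} ε*d≡p (r * r) ℓ εrr<ℓ/1024 in
    <⇒≱ (ExceedsOverE⇒<3* {1} {successWith ε (mergedWords K M m) r} {(K ^ m) ^ r} exceeds) (begin
      3 * successWith ε (mergedWords K M m) r       ≤⟨ m≤n*m (3 * successWith ε (mergedWords K M m) r) 2 ⟩
      2 * (3 * successWith ε (mergedWords K M m) r) ≡⟨ sym (*-assoc 2 3 (successWith ε (mergedWords K M m) r)) ⟩
      6 * successWith ε (mergedWords K M m) r       ≤⟨ 6*successWith≤[K^m]^r r small ⟩
      (K ^ m) ^ r                                   ≡⟨ sym (*-identityˡ ((K ^ m) ^ r)) ⟩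
      1 * (K ^ m) ^ r                               ∎)
    where open ≤-Reasoning

  withoutReplacement : ∀ r → ExceedsOverE 2 (successWithout ε (mergedWords K M m) r) (length (injSeqs r (K ^ m))) →
                       ℤ.+ 1 / 1024 *ℚ ℕ→ℚ ℓ ≤ℚ ε *ℚ ℕ→ℚ (r * r)
  withoutReplacement r exceeds = ℚP.≮⇒≥ λ εrr<ℓ/1024 →
    let small = ε*R<ℓ/1024⇒1024*p*R<ℓ*d {ε} {p} {d} ε*d≡p (r * r) ℓ εrr<ℓ/1024 in
    <⇒≱ (ExceedsOverE⇒<3* {2} {successWithout ε (mergedWords K M m) r} {length (injSeqs r (K ^ m))} exceeds)
      (*-cancelˡ-≤ 2 (begin
      2 * (3 * successWithout ε (mergedWords K M m) r) ≡⟨ sym (*-assoc 2 3 (successWithout ε (mergedWords K M m) r)) ⟩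
      6 * successWithout ε (mergedWords K M m) r       ≤⟨ *-monoʳ-≤ 6 (successWithout≤successWith ε (mergedWords K M m) r) ⟩
      6 * successWith ε (mergedWords K M m) r          ≤⟨ 6*successWith≤[K^m]^r r small ⟩
      (K ^ m) ^ r                                      ≤⟨ [K^m]^r≤2*#injSeqs r small ⟩
      2 * length (injSeqs r (K ^ m))                   ≤⟨ *-monoʳ-≤ 2 (m≤n*m (length (injSeqs r (K ^ m))) 2) ⟩
      2 * (2 * length (injSeqs r (K ^ m)))             ∎))
    where open ≤-Reasoning

lemma3 : ∃[ c ] ∃[ m₀ ] ∃[ ε₀ ] (0ℚ <ℚ c × 0ℚ <ℚ ε₀ ×
           (∀ (m : ℕ) (ε : ℚ) → m₀ ≤ m → 0ℚ <ℚ ε → ε ≤ℚ ε₀ → ε <ℚ 1ℚ →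
             ∃[ n ] Σ (DataSet n m) λ x →
               (∀ (r : ℕ) → ExceedsOverE 1 (successWith ε x r) (n ^ r) →
                 c *ℚ ℕ→ℚ ⌊log₂ m ⌋ ≤ℚ ε *ℚ ℕ→ℚ (r * r))
               × (∀ (r : ℕ) → ExceedsOverE 2 (successWithout ε x r) (length (injSeqs r n)) →
                 c *ℚ ℕ→ℚ ⌊log₂ m ⌋ ≤ℚ ε *ℚ ℕ→ℚ (r * r))))
lemma3 = ℤ.+ 1 / 1024 , 256 , ℤ.+ 1 / 64 , ℚ.*<* (ℤ.+<+ (s≤s z≤n)) , ℚ.*<* (ℤ.+<+ (s≤s z≤n)) ,
  -- ε < 1 already follows from ε ≤ 1/64.
  λ m ε 256≤m 0<ε ε≤1/64 _ →
    let open SmallFraction (smallFraction 0<ε ε≤1/64)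
        (b , 1≤b , 64pbb≤d , d<64p[1+b]²) = isqrt-bracket 1≤num 64*num≤den
        M : ℕ
        M = 2 + 2 * ⌊log₂ m ⌋ * den
        K : ℕ
        K = 4 * b * M
        open HardInstance (8≤⌊log₂n⌋ 256≤m) (2^⌊log₂n⌋≤n m (≤-trans (s≤s z≤n) 256≤m))
                          {ε} ε*den≡num 1≤num 1≤b 64pbb≤d d<64p[1+b]² {M} {K} refl refl
    in K ^ m , mergedWords K M m , withReplacement , withoutReplacement
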